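{- Let $r,c\ge 2$ and $m\ge 0$ be integers, and consider the $r\times c$ cylinder graph. Suppose $P$ is a Hamiltonian path that starts at $(0,0)$, ends at a vertex in the last column $c-1$, and uses at most $(c-1)+2m$ horizontal edges. Then $P$ ends at $(x,c-1)$ for some row index $x\in A_{r,c,m}$.
   Context: An $r\times c$ cylinder graph has vertices $(i,j)$, $0\le i\le r-1$, $0\le j\le c-1$ (row $i$, column $j$); $(i,j)$ is adjacent to $(i,j\pm1)$ when that column index lies in $\{0,\dots,c-1\}$ (horizontal edges) and to $(i\pm1 \bmod r,j)$ (vertical edges). A GG path with $2k+1+(c-2)$ horizontal edges ($k\ge 0$) is a Hamiltonian path of one of two forms. Form 1: it starts at $(0,0)$; then uses $r-2k-1$ consecutive vertical edges along $(0,0),(1,0),\dots,(r-2k-1,0)$; then alternates horizontal and vertical edges using $2k+1$ horizontal edges, along $(r-2k-1,0),(r-2k-1,1),(r-2k,1),(r-2k,0),(r-2k+1,0),\dots,(r-1,0),(r-1,1)$, ending at $(r-1,1)$; then traverses the remaining vertices by traversing (the remaining vertices of) a column, taking one horizontal edge to the next column, traversing that column, and so on, ending in the last column and using $c-2$ additional horizontal edges (one between each remaining pair of consecutive columns). Form 2 (mirror image): starts at $(0,0)$; uses $r-2k-1$ vertical edges along $(0,0),(r-1,0),(r-2,0),\dots,(2k+1,0)$; then alternates along $(2k+1,0),(2k+1,1),(2k,1),(2k,0),\dots,(1,0),(1,1)$ using $2k+1$ horizontal edges, ending at $(1,1)$; then traverses the remaining vertices column by column as in Form 1 with $c-2$ additional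 horizontal edges. $A_{r,c,m}$ denotes the set of row indices $x$ such that some GG path in the $r\times c$ cylinder graph using at most $2m+(c-1)$ horizontal edges ends at $(x,c-1)$. -}

module Defs where

open import Data.Nat using (ℕ; zero; suc; _+_; _*_; _∸_; _≤_; _<_)
open import Data.Bool using (Bool; true; false; not; if_then_else_)
open import Data.Nat using (_≡ᵇ_)
open import Data.Product using (_×_; _,_; proj₁; proj₂; ∃; ∃-syntax; Σ-syntax)
open import Data.Sum using (_⊎_)
open import Data.List using (List; []; _∷_; _++_; map; upTo; _∷ʳ_)
open import Data.List.Relation.Unary.Unique.Propositional using (Unique)
open import Data.List.Relation.Unary.Linked using (Linked)
open import Data.List.Relation.Unary.All using (All)
open import Data.List.Membership.Propositional using (_∈_)
open import Relation.Binary.PropositionalEquality using (_≡_)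

Vertex : Set
Vertex = ℕ × ℕ

row col : Vertex → ℕ
row = proj₁
col = proj₂

InGrid : ℕ → ℕ → Vertex → Set
InGrid r c (i , j) = i < r × j < c

VStep : ℕ → ℕ → ℕ → Set
VStep r i i' = (suc i ≡ i') ⊎ (suc i ≡ r × i' ≡ 0)

-- adjacency in the r × c cylinder graph (columns not wrapped, rows wrapped mod r)
HorAdj : Vertex → Vertex → Set
HorAdj (i , j) (i' , j') = i ≡ i' × (suc j ≡ j' ⊎ suc j' ≡ j)

VerAdj : ℕ → Vertex → Vertex → Set
VerAdj r (i , j) (i' , j') = j ≡ j' × (VStep r i i' ⊎ VStep r i' i)

Adj : ℕ → Vertex → Vertex → Set
Adj r u v = HorAdj u v ⊎ VerAdj r u v

HamPath : ℕ → ℕ → List Vertex → Set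
HamPath r c P =
  All (InGrid r c) P × Unique P × (∀ v → InGrid r c v → v ∈ P) × Linked (Adj r) P

-- number of horizontal edges used by a path (consecutive vertices in
-- different columns; along a path these are exactly the horizontal edges)
hcount : List Vertex → ℕ
hcount [] = 0
hcount (u ∷ []) = 0
hcount (u ∷ v ∷ rest) = (if col u ≡ᵇ col v then 0 else 1) + hcount (v ∷ rest)

-- zig-zag part starting at row a, n rows, b = true means start in column 0
zz : ℕ → ℕ → Bool → List Vertex
zz a zero b = []
zz a (suc n) true  = (a , 0) ∷ (a , 1) ∷ zz (suc a) n false
zz a (suc n) false = (a , 1) ∷ (a , 0) ∷ zz (suc a) n true

-- Form 1 prefix: (0,0),(1,0),…,(r-2k-1,0),(r-2k-1,1),(r-2k,1),(r-2k,0),…,(r-1,0),(r-1,1)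
prefix1 : ℕ → ℕ → List Vertex
prefix1 r k = map (λ i → (i , 0)) (upTo a) ++ zz a (suc (2 * k)) true
  where a = r ∸ suc (2 * k)

reflect : ℕ → ℕ → ℕ
reflect r zero = zero
reflect r (suc i) = r ∸ suc i

-- Form 2 prefix (mirror image of Form 1 under i ↦ -i mod r):
-- (0,0),(r-1,0),…,(2k+1,0),(2k+1,1),(2k,1),(2k,0),…,(1,0),(1,1)
prefix2 : ℕ → ℕ → List Vertex
prefix2 r k = map (λ v → (reflect r (row v) , col v)) (prefix1 r k)

-- GG path with 2k+1+(c-2) horizontal edges: a Hamiltonian path consisting of
-- the Form 1 / Form 2 prefix followed by the remaining vertices traversed
-- column by column (columns weakly increasing from column 1 on).
GGPath : ℕ → ℕ → ℕ → List Vertex → Set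
GGPath r c k Q =
  HamPath r c Q × 2 * k + 1 ≤ r ×
  ∃[ suffix ] ((Q ≡ prefix1 r k ++ suffix ⊎ Q ≡ prefix2 r k ++ suffix)
               × Linked _≤_ (1 ∷ map col suffix))

InA : ℕ → ℕ → ℕ → ℕ → Set
InA r c m x =
  ∃[ k ] ∃[ Q ] (GGPath r c k Q × hcount Q ≤ 2 * m + (c ∸ 1)
                 × ∃[ init ] Q ≡ init ∷ʳ (x , c ∸ 1))

-- Give row i of the cylinder a weight h i with |h i + h (i + 1 mod r)| ≤ 1 and put
-- H (i , j) = (-1)^j h i. Across a horizontal edge H cancels, so summing H u + H v over the
-- steps of a Hamiltonian path shows that H(start) + H(end) is the total of H over both ends of
-- the vertical edges the path does not use; there are hcount + 1 of those, each contributing at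
-- most 1. An alternating weight (r even), the distance to row 0 (r even) and a linear descent
-- (r odd) turn this into: the end row x, or r - x, has the parity of c and is at most 2m + c.
-- Conversely each such row is the end of an explicit GG path: column 0, then a zig-zag over the
-- last 2k + 1 rows, then the remaining columns swept cyclically up or down; reflecting the rows
-- gives the second form.
module Submission where

open import Defs
open import Data.Nat as ℕ using (ℕ; zero; suc; _+_; _*_; _∸_; _≤_; _<_; z≤n; s≤s)
import Data.Nat.Properties as ℕP
open import Data.Integer as ℤ using (ℤ; +_; -_; 0ℤ; 1ℤ; -1ℤ; _⊖_)
  renaming (_+_ to _+ᶻ_; _-_ to _-ᶻ_; _*_ to _*ᶻ_; _≤_ to _≤ᶻ_)
import Data.Integer.Properties as ℤP
open import Data.Integer.Tactic.RingSolver using (solve-∀)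
import Data.Nat.Tactic.RingSolver as ℕSolver
open import Data.Bool using (Bool; true; false; if_then_else_; T)
open import Data.Product as Product using (_×_; _,_; proj₁; proj₂; ∃-syntax)
open import Data.Product.Properties using (≡-dec)
open import Data.Sum using (_⊎_; inj₁; inj₂; [_,_]′)
open import Data.Empty using (⊥-elim)
import Data.Unit
open import Data.List using (List; []; _∷_; _++_; _∷ʳ_; map; filter; length; upTo; replicate)
open import Data.List.Relation.Unary.All as All using (All; []; _∷_)
open import Data.List.Relation.Unary.AllPairs using ([]; _∷_)
open import Data.List.Relation.Unary.Linked using (Linked; []; [-]; _∷_)
open import Data.List.Relation.Unary.Unique.Propositional using (Unique)
import Data.List.Relation.Unary.Unique.Propositional.Properties as Unique
open import Data.List.Relation.Unary.Any using (here; there)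
open import Data.List.Membership.Propositional using (_∈_; _∉_)
open import Data.List.Membership.Propositional.Properties using (∈-filter⁺; ∈-filter⁻; ∈-map⁺; ∈-map⁻; ∈-++⁺ˡ; ∈-++⁺ʳ; ∈-++⁻)
import Data.List.Relation.Unary.All.Properties as All
open import Data.List.Relation.Binary.Subset.Propositional using (_⊆_)
import Data.List.Properties as ListP
open import Relation.Binary.PropositionalEquality
  using (_≡_; _≢_; refl; sym; trans; cong; cong₂; subst; subst₂; module ≡-Reasoning)
open import Relation.Binary.Definitions using (DecidableEquality)
open import Function using (id; _∘_; _∘′_)
open import Relation.Nullary using (¬_; yes; no; ¬?)

sign : ℕ → ℤ
sign zero = 1ℤ
sign (suc j) = - sign j

sign-±1 : ∀ j → sign j ≡ 1ℤ ⊎ sign j ≡ -1ℤ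
sign-±1 zero = inj₁ refl
sign-±1 (suc j) with sign-±1 j
... | inj₁ e = inj₂ (cong -_ e)
... | inj₂ e = inj₁ (cong -_ e)

sign-+ : ∀ a b → sign (a + b) ≡ sign a *ᶻ sign b
sign-+ zero b = sym (ℤP.*-identityˡ (sign b))
sign-+ (suc a) b = trans (cong -_ (sign-+ a b)) (ℤP.neg-distribˡ-* (sign a) (sign b))

sign-2* : ∀ q → sign (2 * q) ≡ 1ℤ
sign-2* zero = refl
sign-2* (suc q) = trans (cong (λ n → - sign n) (ℕP.+-suc q (q + 0))) (trans (ℤP.neg-involutive _) (sign-2* q))

sign-2*+ : ∀ q n → sign (2 * q + n) ≡ sign n
sign-2*+ q n = trans (sign-+ (2 * q) n) (trans (cong (_*ᶻ sign n) (sign-2* q)) (ℤP.*-identityˡ (sign n)))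

sign-sq : ∀ j → sign j *ᶻ sign j ≡ 1ℤ
sign-sq j with sign-±1 j
... | inj₁ eq rewrite eq = refl
... | inj₂ eq rewrite eq = refl

sign-∸ : ∀ {r x} → x ≤ r → sign (r ∸ x) ≡ sign r *ᶻ sign x
sign-∸ {r} {x} x≤r = begin
  sign (r ∸ x)                               ≡⟨ sym (ℤP.*-identityˡ _) ⟩
  1ℤ *ᶻ sign (r ∸ x)                         ≡⟨ cong (_*ᶻ sign (r ∸ x)) (sym (sign-sq x)) ⟩
  sign x *ᶻ sign x *ᶻ sign (r ∸ x)           ≡⟨ regroup (sign x) (sign (r ∸ x)) ⟩
  (sign x *ᶻ sign (r ∸ x)) *ᶻ sign x         ≡⟨ cong (_*ᶻ sign x) (sym (sign-+ x (r ∸ x))) ⟩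
  sign (x + (r ∸ x)) *ᶻ sign x               ≡⟨ cong (λ n → sign n *ᶻ sign x) (ℕP.m+[n∸m]≡n x≤r) ⟩
  sign r *ᶻ sign x                           ∎
  where
  open ≡-Reasoning
  regroup : ∀ a b → a *ᶻ a *ᶻ b ≡ a *ᶻ b *ᶻ a
  regroup = solve-∀

sign-cases : ∀ a b → sign a ≡ sign b ⊎ sign a ≡ - sign b
sign-cases a b with sign-±1 a | sign-±1 b
... | inj₁ p | inj₁ q = inj₁ (trans p (sym q))
... | inj₁ p | inj₂ q = inj₂ (trans p (cong -_ (sym q)))
... | inj₂ p | inj₁ q = inj₂ (trans p (cong -_ (sym q)))
... | inj₂ p | inj₂ q = inj₁ (trans p (sym q))

sign≢-sign : ∀ a → sign a ≢ - sign a
sign≢-sign a eq with sign-±1 a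
... | inj₁ p with () ← trans (sym p) (trans eq (cong -_ p))
... | inj₂ p with () ← trans (sym p) (trans eq (cong -_ p))

sign≡1⇒even : ∀ n → sign n ≡ 1ℤ → ∃[ q ] n ≡ 2 * q
sign≡-1⇒odd : ∀ n → sign n ≡ -1ℤ → ∃[ q ] n ≡ suc (2 * q)
sign≡1⇒even zero _ = 0 , refl
sign≡1⇒even (suc n) eq with sign≡-1⇒odd n (ℤP.neg-injective eq)
... | q , refl = suc q , cong suc (sym (ℕP.+-suc q (q + 0)))
sign≡-1⇒odd zero ()
sign≡-1⇒odd (suc n) eq with sign≡1⇒even n (ℤP.neg-injective eq)
... | q , refl = q , refl

sign-≡⇒even-gap : ∀ a d → sign a ≡ sign (a + d) → ∃[ q ] d ≡ 2 * q
sign-≡⇒even-gap zero d eq = sign≡1⇒even d (sym eq)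
sign-≡⇒even-gap (suc a) d eq = sign-≡⇒even-gap a d (ℤP.neg-injective eq)

≤-pred-by-sign : ∀ {e n} → sign e ≡ sign n → e ≤ suc n → e ≤ n
≤-pred-by-sign {e} {n} eq e≤1+n with ℕP.m≤n⇒m<n∨m≡n e≤1+n
... | inj₁ e<1+n = ℕP.≤-pred e<1+n
... | inj₂ refl = ⊥-elim (sign≢-sign n (sym eq))

sumOf : {A : Set} → (A → ℤ) → List A → ℤ
sumOf f [] = 0ℤ
sumOf f (x ∷ xs) = f x +ᶻ sumOf f xs

sumOf-+ : {A : Set} (f g : A → ℤ) → ∀ xs → sumOf (λ v → f v +ᶻ g v) xs ≡ sumOf f xs +ᶻ sumOf g xs
sumOf-+ f g [] = refl
sumOf-+ f g (x ∷ xs) = trans (cong (f x +ᶻ g x +ᶻ_) (sumOf-+ f g xs)) (swap (f x) (g x) _ _)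
  where
  swap : ∀ a b c d → a +ᶻ b +ᶻ (c +ᶻ d) ≡ a +ᶻ c +ᶻ (b +ᶻ d)
  swap = solve-∀

sumOf-map : {A B : Set} (f : B → ℤ) (g : A → B) → ∀ xs → sumOf f (map g xs) ≡ sumOf (λ v → f (g v)) xs
sumOf-map f g [] = refl
sumOf-map f g (x ∷ xs) = cong (f (g x) +ᶻ_) (sumOf-map f g xs)

sumOf-one-minus : {A : Set} (f : A → ℤ) → ∀ xs → sumOf (λ v → 1ℤ -ᶻ f v) xs ≡ + length xs -ᶻ sumOf f xs
sumOf-one-minus f [] = refl
sumOf-one-minus f (x ∷ xs) = trans (cong ((1ℤ -ᶻ f x) +ᶻ_) (sumOf-one-minus f xs)) (shuffle (f x) (+ length xs) (sumOf f xs))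
  where
  shuffle : ∀ a n s → 1ℤ -ᶻ a +ᶻ (n -ᶻ s) ≡ 1ℤ +ᶻ n -ᶻ (a +ᶻ s)
  shuffle = solve-∀

sumOf-nonneg : {A : Set} (f : A → ℤ) → ∀ xs → (∀ {v} → v ∈ xs → 0ℤ ≤ᶻ f v) → 0ℤ ≤ᶻ sumOf f xs
sumOf-nonneg f [] _ = ℤP.≤-refl
sumOf-nonneg f (x ∷ xs) f≥0 = ℤP.+-mono-≤ (f≥0 (here refl)) (sumOf-nonneg f xs (f≥0 ∘′ there))

module _ {A : Set} (_≟_ : DecidableEquality A) where

  remove : A → List A → List A
  remove x = filter (λ y → ¬? (y ≟ x))

  ∈-remove⁺ : ∀ {x y xs} → y ∈ xs → y ≢ x → y ∈ remove x xs
  ∈-remove⁺ = ∈-filter⁺ (λ y → ¬? (y ≟ _))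

  ∈-remove⁻ : ∀ {x y xs} → y ∈ remove x xs → y ∈ xs × y ≢ x
  ∈-remove⁻ = ∈-filter⁻ (λ y → ¬? (y ≟ _))

  remove-unique : ∀ {x xs} → Unique xs → Unique (remove x xs)
  remove-unique = Unique.filter⁺ (λ y → ¬? (y ≟ _))

  sumOf-remove : (f : A → ℤ) → ∀ {x xs} → Unique xs → x ∈ xs → sumOf f xs ≡ f x +ᶻ sumOf f (remove x xs)
  sumOf-remove f {x} {.x ∷ xs} (x∉xs ∷ _) (here refl) = cong (λ l → f x +ᶻ sumOf f l) (sym removed)
    where
    removed : remove x (x ∷ xs) ≡ xs
    removed = trans (ListP.filter-reject (λ y → ¬? (y ≟ x)) (λ x≢x → x≢x refl))
                    (ListP.filter-all (λ y → ¬? (y ≟ x)) (All.map (λ x≢y y≡x → x≢y (sym y≡x)) x∉xs))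
  sumOf-remove f {x} {y ∷ xs} (y∉xs ∷ uq) (there x∈xs) = begin
    f y +ᶻ sumOf f xs                            ≡⟨ cong (f y +ᶻ_) (sumOf-remove f uq x∈xs) ⟩
    f y +ᶻ (f x +ᶻ sumOf f (remove x xs))       ≡⟨ swap (f y) (f x) _ ⟩
    f x +ᶻ (f y +ᶻ sumOf f (remove x xs))       ≡⟨ cong (λ l → f x +ᶻ sumOf f l) (sym kept) ⟩
    f x +ᶻ sumOf f (remove x (y ∷ xs))           ∎
    where
    open ≡-Reasoning
    kept : remove x (y ∷ xs) ≡ y ∷ remove x xs
    kept = ListP.filter-accept (λ z → ¬? (z ≟ x)) (All.lookup y∉xs x∈xs)
    swap : ∀ a b c → a +ᶻ (b +ᶻ c) ≡ b +ᶻ (a +ᶻ c)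
    swap = solve-∀

  private
    remove-⊆ : ∀ {x xs ys} → Unique (x ∷ xs) → (x ∷ xs) ⊆ ys → xs ⊆ remove x ys
    remove-⊆ (x∉xs ∷ _) sub y∈xs = ∈-remove⁺ (sub (there y∈xs)) (λ y≡x → All.lookup x∉xs y∈xs (sym y≡x))

  sumOf-mono-⊆ : (f : A → ℤ) → ∀ {xs ys} → Unique xs → Unique ys → xs ⊆ ys →
                 (∀ {v} → v ∈ ys → 0ℤ ≤ᶻ f v) → sumOf f xs ≤ᶻ sumOf f ys
  sumOf-mono-⊆ f {[]} _ _ _ f≥0 = sumOf-nonneg f _ f≥0
  sumOf-mono-⊆ f {x ∷ xs} {ys} uxs@(_ ∷ uxs′) uys sub f≥0 = begin
    f x +ᶻ sumOf f xs              ≤⟨ ℤP.+-monoʳ-≤ (f x) (sumOf-mono-⊆ f uxs′ (remove-unique uys) (remove-⊆ uxs sub)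
                                                                          (f≥0 ∘ proj₁ ∘ ∈-remove⁻)) ⟩
    f x +ᶻ sumOf f (remove x ys)   ≡⟨ sym (sumOf-remove f uys (sub (here refl))) ⟩
    sumOf f ys                     ∎
    where open ℤP.≤-Reasoning

  sumOf-sameElements : (f : A → ℤ) → ∀ {xs ys} → Unique xs → Unique ys → xs ⊆ ys → ys ⊆ xs →
                       sumOf f xs ≡ sumOf f ys
  sumOf-sameElements f {[]} {[]} _ _ _ _ = refl
  sumOf-sameElements f {[]} {y ∷ ys} _ _ _ sup with sup (here refl)
  ... | ()
  sumOf-sameElements f {x ∷ xs} {ys} uxs@(_ ∷ uxs′) uys sub sup =
    trans (cong (f x +ᶻ_) (sumOf-sameElements f uxs′ (remove-unique uys) (remove-⊆ uxs sub) sup′))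
          (sym (sumOf-remove f uys (sub (here refl))))
    where
    sup′ : remove x ys ⊆ xs
    sup′ y∈ with ∈-remove⁻ y∈
    ... | y∈ys , y≢x with sup y∈ys
    ...   | here y≡x = ⊥-elim (y≢x y≡x)
    ...   | there y∈xs = y∈xs

next : ℕ → ℕ → ℕ
next r i with suc i ℕ.≟ r
... | yes _ = 0
... | no _ = suc i

next-cases : ∀ r i → (suc i ≡ r × next r i ≡ 0) ⊎ (suc i ≢ r × next r i ≡ suc i)
next-cases r i with suc i ℕ.≟ r
... | yes e = inj₁ (e , refl)
... | no ne = inj₂ (ne , refl)

next-< : ∀ {r i} → i < r → next r i < r
next-< {r} {i} i<r with next-cases r i
... | inj₁ (_ , eq) rewrite eq = ℕP.≤-trans (s≤s z≤n) i<r
... | inj₂ (ne , eq) rewrite eq = ℕP.≤∧≢⇒< i<r ne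

VStep-next : ∀ r i → VStep r i (next r i)
VStep-next r i with next-cases r i
... | inj₁ (e , eq) rewrite eq = inj₂ (e , refl)
... | inj₂ (_ , eq) rewrite eq = inj₁ refl

VStep⇒≡next : ∀ {r i i′} → i′ < r → VStep r i i′ → i′ ≡ next r i
VStep⇒≡next {r} {i} i′<r step with next-cases r i | step
... | inj₁ (refl , _) | inj₁ refl = ⊥-elim (ℕP.<-irrefl refl i′<r)
... | inj₁ (_ , eq)   | inj₂ (_ , refl) = sym eq
... | inj₂ (_ , eq)   | inj₁ refl = sym eq
... | inj₂ (ne , _)   | inj₂ (e , _) = ⊥-elim (ne e)

next-injective : ∀ {r i i′} → next r i ≡ next r i′ → i ≡ i′
next-injective {r} {i} {i′} e with next-cases r i | next-cases r i′
... | inj₁ (a , _) | inj₁ (b , _) = ℕP.suc-injective (trans a (sym b))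
... | inj₁ (_ , p) | inj₂ (_ , q) = ⊥-elim (ℕP.0≢1+n (trans (sym p) (trans e q)))
... | inj₂ (_ , p) | inj₁ (_ , q) = ⊥-elim (ℕP.0≢1+n (trans (sym q) (trans (sym e) p)))
... | inj₂ (_ , p) | inj₂ (_ , q) = ℕP.suc-injective (trans (sym p) (trans e q))

prev : ℕ → ℕ → ℕ
prev r zero = r ∸ 1
prev r (suc i) = i

prev-< : ∀ {r i} → i < r → prev r i < r
prev-< {suc r} {zero} _ = ℕP.n<1+n r
prev-< {r} {suc i} i<r = ℕP.<-trans (ℕP.n<1+n i) i<r

next-prev : ∀ {r i} → i < r → next r (prev r i) ≡ i
next-prev {suc r} {zero} _ = sym (VStep⇒≡next (s≤s z≤n) (inj₂ (refl , refl)))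
next-prev {r} {suc i} i<r = sym (VStep⇒≡next i<r (inj₁ refl))

RowAdj : ℕ → ℕ → ℕ → Set
RowAdj r i i′ = VStep r i i′ ⊎ VStep r i′ i

reflect-< : ∀ {r i} → i < r → reflect r i < r
reflect-< {r} {zero} 0<r = 0<r
reflect-< {suc r} {suc i} _ = s≤s (ℕP.m∸n≤m r i)

reflect-involutive : ∀ {r i} → i < r → reflect r (reflect r i) ≡ i
reflect-involutive {r} {zero} _ = refl
reflect-involutive {r} {suc i} i<r with r ∸ suc i in eq
... | zero = ⊥-elim (ℕP.m>n⇒m∸n≢0 i<r eq)
... | suc _ = trans (cong (r ∸_) (sym eq)) (ℕP.m∸[m∸n]≡n (ℕP.<⇒≤ i<r))

reflect-VStep : ∀ {r i i′} → i′ < r → VStep r i i′ → VStep r (reflect r i′) (reflect r i)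
reflect-VStep {suc r} {zero} _ (inj₁ refl) = inj₂ (refl , refl)
reflect-VStep {suc r} {suc i} (s≤s i′<r) (inj₁ refl) = inj₁ (sym (ℕP.+-∸-assoc 1 (ℕP.<⇒≤ i′<r)))
reflect-VStep {r} {zero} _ (inj₂ (e , refl)) = inj₂ (e , refl)
reflect-VStep {r} {suc i} _ (inj₂ (refl , refl)) = inj₁ (sym (ℕP.m+n∸n≡m 1 (suc i)))

reflect-RowAdj : ∀ {r i i′} → i < r → i′ < r → RowAdj r i i′ → RowAdj r (reflect r i) (reflect r i′)
reflect-RowAdj _ i′<r (inj₁ s) = inj₂ (reflect-VStep i′<r s)
reflect-RowAdj i<r _ (inj₂ s) = inj₁ (reflect-VStep i<r s)

lastOf : {A : Set} → A → List A → A
lastOf a [] = a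
lastOf a (b ∷ bs) = lastOf b bs

lastOf-∈ : {A : Set} (a : A) (xs : List A) → lastOf a xs ∈ a ∷ xs
lastOf-∈ a [] = here refl
lastOf-∈ a (b ∷ bs) = there (lastOf-∈ b bs)

lastOf-map : {A B : Set} (f : A → B) (a : A) (xs : List A) → lastOf (f a) (map f xs) ≡ f (lastOf a xs)
lastOf-map f a [] = refl
lastOf-map f a (b ∷ bs) = lastOf-map f b bs

lastOf-++ : {A : Set} (a : A) (xs : List A) (b : A) (ys : List A) → lastOf a (xs ++ b ∷ ys) ≡ lastOf b ys
lastOf-++ a [] b ys = refl
lastOf-++ a (x ∷ xs) b ys = lastOf-++ x xs b ys

∷-≡-∷ʳ-lastOf : {A : Set} (a : A) (xs : List A) → ∃[ init ] a ∷ xs ≡ init ∷ʳ lastOf a xs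
∷-≡-∷ʳ-lastOf a [] = [] , refl
∷-≡-∷ʳ-lastOf a (b ∷ bs) with ∷-≡-∷ʳ-lastOf b bs
... | init , eq = a ∷ init , cong (a ∷_) eq

∷ʳ⇒lastOf : {A : Set} (a : A) (xs : List A) (init : List A) (z : A) → a ∷ xs ≡ init ∷ʳ z → lastOf a xs ≡ z
∷ʳ⇒lastOf a xs [] z refl = refl
∷ʳ⇒lastOf a xs (x ∷ init) z refl = lastOf-++ a init z []

Linked-++ : {A : Set} {R : A → A → Set} {a b : A} {xs ys : List A} →
            Linked R (a ∷ xs) → R (lastOf a xs) b → Linked R (b ∷ ys) → Linked R ((a ∷ xs) ++ (b ∷ ys))
Linked-++ {xs = []} [-] Rab Rys = Rab ∷ Rys
Linked-++ {xs = x ∷ xs} (Rax ∷ Rxs) Rlb Rys = Rax ∷ Linked-++ Rxs Rlb Rys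

Linked-map : {A B : Set} {R : A → A → Set} {S : B → B → Set} {P : A → Set} (f : A → B) →
             (∀ {x y} → P x → P y → R x y → S (f x) (f y)) → ∀ {xs} → All P xs → Linked R xs → Linked S (map f xs)
Linked-map f pres _ [] = []
Linked-map f pres _ [-] = [-]
Linked-map f pres (px ∷ ps@(py ∷ _)) (Rxy ∷ Rs) = pres px py Rxy ∷ Linked-map f pres ps Rs

≡ᵇ-true⇒≡ : ∀ {m n} → (m ℕ.≡ᵇ n) ≡ true → m ≡ n
≡ᵇ-true⇒≡ {m} {n} eq = ℕP.≡ᵇ⇒≡ m n (subst T (sym eq) _)

≡ᵇ-false⇒≢ : ∀ {m n} → (m ℕ.≡ᵇ n) ≡ false → m ≢ n
≡ᵇ-false⇒≢ {m} {n} eq m≡n = subst T eq (ℕP.≡⇒≡ᵇ m n m≡n)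

≡ᵇ-refl : ∀ n → (n ℕ.≡ᵇ n) ≡ true
≡ᵇ-refl zero = refl
≡ᵇ-refl (suc n) = ≡ᵇ-refl n

≡ᵇ-suc : ∀ n → (n ℕ.≡ᵇ suc n) ≡ false
≡ᵇ-suc zero = refl
≡ᵇ-suc (suc n) = ≡ᵇ-suc n

hcount-++ : ∀ a xs b ys → hcount ((a ∷ xs) ++ (b ∷ ys)) ≡
            hcount (a ∷ xs) + ((if col (lastOf a xs) ℕ.≡ᵇ col b then 0 else 1) + hcount (b ∷ ys))
hcount-++ a [] b ys = refl
hcount-++ a (x ∷ xs) b ys = trans (cong (_+_ (if col a ℕ.≡ᵇ col x then 0 else 1)) (hcount-++ x xs b ys))
                                 (sym (ℕP.+-assoc (if col a ℕ.≡ᵇ col x then 0 else 1) (hcount (x ∷ xs)) _))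

-- The potential bound

_≟V_ : DecidableEquality Vertex
_≟V_ = ≡-dec ℕ._≟_ ℕ._≟_

nextV : ℕ → Vertex → Vertex
nextV r (i , j) = (next r i , j)

nextV-injective : ∀ {r u v} → nextV r u ≡ nextV r v → u ≡ v
nextV-injective {u = i , j} {i′ , j′} e = cong₂ _,_ (next-injective (cong proj₁ e)) (cong proj₂ e)

lowerEnd : ℕ → Vertex → Vertex → Vertex
lowerEnd r (i , j) (i′ , j′) with i′ ℕ.≟ next r i
... | yes _ = (i , j)
... | no _ = (i′ , j′)

lowerEnd-spec : ∀ {r c u v} → InGrid r c u → InGrid r c v → Adj r u v → col u ≡ col v →
  (u ≡ lowerEnd r u v × v ≡ nextV r u) ⊎ (v ≡ lowerEnd r u v × u ≡ nextV r v)
lowerEnd-spec {r} {u = i , j} {i′ , j′} _ _ adj j≡j′ with i′ ℕ.≟ next r i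
... | yes e = inj₁ (refl , cong₂ _,_ e (sym j≡j′))
lowerEnd-spec _ _ (inj₁ (_ , inj₁ e)) j≡j′ | no _ = ⊥-elim (ℕP.1+n≢n (trans e (sym j≡j′)))
lowerEnd-spec _ _ (inj₁ (_ , inj₂ e)) j≡j′ | no _ = ⊥-elim (ℕP.1+n≢n (trans e j≡j′))
lowerEnd-spec _ (i′<r , _) (inj₂ (_ , inj₁ s)) _ | no ne = ⊥-elim (ne (VStep⇒≡next i′<r s))
lowerEnd-spec (i<r , _) _ (inj₂ (_ , inj₂ s)) j≡j′ | no _ = inj₂ (refl , cong₂ _,_ (VStep⇒≡next i<r s) j≡j′)

verticalSteps : ℕ → List Vertex → List Vertex
verticalSteps r [] = []
verticalSteps r (u ∷ []) = []
verticalSteps r (u ∷ v ∷ rest) =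
  if col u ℕ.≡ᵇ col v then lowerEnd r u v ∷ verticalSteps r (v ∷ rest) else verticalSteps r (v ∷ rest)

module _ {r c : ℕ} where

  verticalSteps-⊆ : ∀ {L e} → All (InGrid r c) L → Linked (Adj r) L →
                    e ∈ verticalSteps r L → e ∈ L × nextV r e ∈ L
  verticalSteps-⊆ {u ∷ v ∷ rest} (gu ∷ gs@(gv ∷ _)) (adj ∷ lk) e∈ with col u ℕ.≡ᵇ col v in eq | e∈
  ... | false | e∈′ = Product.map there there (verticalSteps-⊆ gs lk e∈′)
  ... | true | there e∈′ = Product.map there there (verticalSteps-⊆ gs lk e∈′)
  ... | true | here refl with lowerEnd-spec gu gv adj (≡ᵇ-true⇒≡ eq)
  ...   | inj₁ (p , q) = here (sym p) , there (here (trans (cong (nextV r) (sym p)) (sym q)))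
  ...   | inj₂ (p , q) = there (here (sym p)) , here (trans (cong (nextV r) (sym p)) (sym q))

  verticalSteps-unique : ∀ {L} → All (InGrid r c) L → Linked (Adj r) L → Unique L → Unique (verticalSteps r L)
  verticalSteps-unique {[]} _ _ _ = []
  verticalSteps-unique {u ∷ []} _ _ _ = []
  verticalSteps-unique {u ∷ v ∷ rest} (gu ∷ gs@(gv ∷ _)) (adj ∷ lk) (u∉ ∷ uq) with col u ℕ.≡ᵇ col v in eq
  ... | false = verticalSteps-unique gs lk uq
  ... | true = All.tabulate fresh ∷ verticalSteps-unique gs lk uq
    where
    u∉rest : u ∉ v ∷ rest
    u∉rest u∈ = All.lookup u∉ u∈ refl
    fresh : ∀ {e} → e ∈ verticalSteps r (v ∷ rest) → lowerEnd r u v ≢ e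
    fresh e∈ refl with verticalSteps-⊆ gs lk e∈ | lowerEnd-spec gu gv adj (≡ᵇ-true⇒≡ eq)
    ... | e∈rest , _ | inj₁ (p , _) = u∉rest (subst (_∈ v ∷ rest) (sym p) e∈rest)
    ... | _ , e′∈rest | inj₂ (p , q) = u∉rest (subst (_∈ v ∷ rest) (trans (cong (nextV r) (sym p)) (sym q)) e′∈rest)

length-verticalSteps : ∀ r a rest → length (verticalSteps r (a ∷ rest)) + hcount (a ∷ rest) ≡ length rest
length-verticalSteps r a [] = refl
length-verticalSteps r u (v ∷ rest) with col u ℕ.≡ᵇ col v
... | true = cong suc (length-verticalSteps r v rest)
... | false = trans (ℕP.+-suc _ _) (cong suc (length-verticalSteps r v rest))

UnitBounded : ℤ → Set
UnitBounded z = -1ℤ ≤ᶻ z × z ≤ᶻ 1ℤ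

module Potential (r : ℕ) (h : ℕ → ℤ) where

  H : Vertex → ℤ
  H (i , j) = sign j *ᶻ h i

  F : Vertex → ℤ
  F v = H v +ᶻ H (nextV r v)

  H-horizontal : ∀ {u v} → HorAdj u v → H u +ᶻ H v ≡ 0ℤ
  H-horizontal {i , j} {.i , .(suc j)} (refl , inj₁ refl) = cancel (sign j) (h i)
    where
    cancel : ∀ s a → s *ᶻ a +ᶻ (- s) *ᶻ a ≡ 0ℤ
    cancel = solve-∀
  H-horizontal {i , .(suc j)} {.i , j} (refl , inj₂ refl) = cancel (sign j) (h i)
    where
    cancel : ∀ s a → (- s) *ᶻ a +ᶻ s *ᶻ a ≡ 0ℤ
    cancel = solve-∀

  H-vertical : ∀ {c u v} → InGrid r c u → InGrid r c v → Adj r u v → col u ≡ col v →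
               H u +ᶻ H v ≡ F (lowerEnd r u v)
  H-vertical {u = u} {v} gu gv adj eq with lowerEnd r u v | lowerEnd-spec gu gv adj eq
  ... | _ | inj₁ (refl , refl) = refl
  ... | _ | inj₂ (refl , refl) = ℤP.+-comm (H (nextV r v)) (H v)

  -- Summing H u + H v over the steps of a path counts every inner vertex twice.
  sumOf-verticalSteps : ∀ {c} a rest → All (InGrid r c) (a ∷ rest) → Linked (Adj r) (a ∷ rest) →
    sumOf F (verticalSteps r (a ∷ rest)) +ᶻ H a +ᶻ H (lastOf a rest) ≡ sumOf H (a ∷ rest) +ᶻ sumOf H (a ∷ rest)
  sumOf-verticalSteps a [] _ _ = double (H a)
    where
    double : ∀ x → 0ℤ +ᶻ x +ᶻ x ≡ x +ᶻ 0ℤ +ᶻ (x +ᶻ 0ℤ)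
    double = solve-∀
  sumOf-verticalSteps u (v ∷ rest) (gu ∷ gs@(gv ∷ _)) (adj ∷ lk) with col u ℕ.≡ᵇ col v in eq
  ... | true = step (sym (H-vertical gu gv adj (≡ᵇ-true⇒≡ eq))) (sumOf-verticalSteps v rest gs lk)
    where
    step : ∀ {Fe S Hv Hl Σ} → Fe ≡ H u +ᶻ Hv → S +ᶻ Hv +ᶻ Hl ≡ Σ +ᶻ Σ →
           Fe +ᶻ S +ᶻ H u +ᶻ Hl ≡ H u +ᶻ Σ +ᶻ (H u +ᶻ Σ)
    step {S = S} {Hv} {Hl} {Σ} refl ih =
      trans (shuffle (H u) Hv S Hl) (trans (cong (H u +ᶻ H u +ᶻ_) ih) (regroup (H u) Σ))
      where
      shuffle : ∀ a b s l → a +ᶻ b +ᶻ s +ᶻ a +ᶻ l ≡ a +ᶻ a +ᶻ (s +ᶻ b +ᶻ l)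
      shuffle = solve-∀
      regroup : ∀ a σ → a +ᶻ a +ᶻ (σ +ᶻ σ) ≡ a +ᶻ σ +ᶻ (a +ᶻ σ)
      regroup = solve-∀
  ... | false = step {S = sumOf F (verticalSteps r (v ∷ rest))} {Hl = H (lastOf v rest)}
                     (H-horizontal (horizontal adj)) (sumOf-verticalSteps v rest gs lk)
    where
    horizontal : Adj r u v → HorAdj u v
    horizontal (inj₁ hor) = hor
    horizontal (inj₂ (same , _)) = ⊥-elim (≡ᵇ-false⇒≢ eq same)
    step : ∀ {S Hv Hl Σ} → H u +ᶻ Hv ≡ 0ℤ → S +ᶻ Hv +ᶻ Hl ≡ Σ +ᶻ Σ →
           S +ᶻ H u +ᶻ Hl ≡ H u +ᶻ Σ +ᶻ (H u +ᶻ Σ)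
    step {S} {Hv} {Hl} {Σ} cancel ih =
      trans (shuffle (H u) Hv S Hl) (trans (cong₂ _-ᶻ_ (cong (H u +ᶻ H u +ᶻ_) ih) cancel) (regroup (H u) Hv Σ))
      where
      shuffle : ∀ a b s l → s +ᶻ a +ᶻ l ≡ a +ᶻ a +ᶻ (s +ᶻ b +ᶻ l) -ᶻ (a +ᶻ b)
      shuffle = solve-∀
      regroup : ∀ a b σ → a +ᶻ a +ᶻ (σ +ᶻ σ) -ᶻ 0ℤ ≡ a +ᶻ σ +ᶻ (a +ᶻ σ)
      regroup = solve-∀

  sumOf-F : ∀ {c L} → HamPath r c L → sumOf F L ≡ sumOf H L +ᶻ sumOf H L
  sumOf-F {c} {L} (inGrid , uq , covers , _) = begin
    sumOf F L                                   ≡⟨ sumOf-+ H (H ∘ nextV r) L ⟩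
    sumOf H L +ᶻ sumOf (H ∘ nextV r) L          ≡⟨ cong (sumOf H L +ᶻ_) (sym (sumOf-map H (nextV r) L)) ⟩
    sumOf H L +ᶻ sumOf H (map (nextV r) L)      ≡⟨ cong (sumOf H L +ᶻ_) shift-invariant ⟩
    sumOf H L +ᶻ sumOf H L                      ∎
    where
    open ≡-Reasoning
    shifted⊆ : map (nextV r) L ⊆ L
    shifted⊆ w∈ with ∈-map⁻ (nextV r) w∈
    ... | (i , j) , v∈ , refl with All.lookup inGrid v∈
    ...   | i<r , j<c = covers (next r i , j) (next-< i<r , j<c)
    ⊆shifted : L ⊆ map (nextV r) L
    ⊆shifted {i , j} v∈ with All.lookup inGrid v∈
    ... | i<r , j<c = subst (_∈ map (nextV r) L) (cong (_, j) (next-prev i<r))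
                            (∈-map⁺ (nextV r) (covers (prev r i , j) (prev-< i<r , j<c)))
    shift-invariant : sumOf H (map (nextV r) L) ≡ sumOf H L
    shift-invariant = sumOf-sameElements _≟V_ H (Unique.map⁺ nextV-injective uq) uq shifted⊆ ⊆shifted

  module _ (bounded : ∀ i → i < r → UnitBounded (h i +ᶻ h (next r i))) where

    F-≤1 : ∀ {c v} → InGrid r c v → F v ≤ᶻ 1ℤ
    F-≤1 {v = i , j} (i<r , _) with sign-±1 j | bounded i i<r
    ... | inj₁ eq | _ , ≤1 rewrite eq = subst (_≤ᶻ 1ℤ) (sym (unit (h i) (h (next r i)))) ≤1
      where
      unit : ∀ a b → 1ℤ *ᶻ a +ᶻ 1ℤ *ᶻ b ≡ a +ᶻ b
      unit = solve-∀
    ... | inj₂ eq | -1≤ , _ rewrite eq = subst (_≤ᶻ 1ℤ) (sym (negate (h i) (h (next r i)))) (ℤP.neg-mono-≤ -1≤)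
      where
      negate : ∀ a b → -1ℤ *ᶻ a +ᶻ -1ℤ *ᶻ b ≡ - (a +ᶻ b)
      negate = solve-∀

    -- Comparing sums of G = 1 - F ≥ 0 over the used and over all vertical edges avoids listing
    -- the unused ones.
    endpoint-bound : ∀ {c a rest} → HamPath r c (a ∷ rest) →
                     H a +ᶻ H (lastOf a rest) ≤ᶻ + hcount (a ∷ rest) +ᶻ 1ℤ
    endpoint-bound {c} {a} {rest} hp@(inGrid , uq , _ , lk) = begin
        H a +ᶻ H (lastOf a rest)            ≡⟨ solve-for-ends (sumOf-one-minus F V) (sumOf-verticalSteps a rest inGrid lk) ⟩
        sumOf G V -ᶻ + length V +ᶻ ΣH₂      ≤⟨ ℤP.+-monoˡ-≤ ΣH₂ (ℤP.+-monoˡ-≤ (- + length V) ΣG-V≤ΣG-L) ⟩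
        sumOf G L -ᶻ + length V +ᶻ ΣH₂      ≡⟨ count-unused (trans (sumOf-one-minus F L)
                                                                  (cong (+ length L -ᶻ_) (sumOf-F hp))) ⟩
        + hcount L +ᶻ 1ℤ                    ∎
      where
      open ℤP.≤-Reasoning
      L = a ∷ rest
      V = verticalSteps r L
      ΣH₂ = sumOf H L +ᶻ sumOf H L
      G : Vertex → ℤ
      G v = 1ℤ -ᶻ F v
      ΣG-V≤ΣG-L : sumOf G V ≤ᶻ sumOf G L
      ΣG-V≤ΣG-L = sumOf-mono-⊆ _≟V_ G (verticalSteps-unique inGrid lk uq) uq
                    (proj₁ ∘ verticalSteps-⊆ inGrid lk)
                    (λ v∈ → ℤP.i≤j⇒0≤j-i (F-≤1 (All.lookup inGrid v∈)))
      solve-for-ends : ∀ {g s} → g ≡ + length V -ᶻ sumOf F V → sumOf F V +ᶻ H a +ᶻ H (lastOf a rest) ≡ s →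
                       H a +ᶻ H (lastOf a rest) ≡ g -ᶻ + length V +ᶻ s
      solve-for-ends refl refl = eq (+ length V) (sumOf F V) (H a) (H (lastOf a rest))
        where
        eq : ∀ n f x y → x +ᶻ y ≡ n -ᶻ f -ᶻ n +ᶻ (f +ᶻ x +ᶻ y)
        eq = solve-∀
      count-unused : ∀ {g} → g ≡ + length L -ᶻ ΣH₂ → g -ᶻ + length V +ᶻ ΣH₂ ≡ + hcount L +ᶻ 1ℤ
      count-unused refl = trans (cong (λ n → n -ᶻ ΣH₂ -ᶻ + length V +ᶻ ΣH₂) length-L) (cancel (+ length V) (+ hcount L) ΣH₂)
        where
        length-L : + length L ≡ 1ℤ +ᶻ (+ length V +ᶻ + hcount L)
        length-L = trans (cong (λ n → + suc n) (sym (length-verticalSteps r a rest)))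
                         (trans (ℤP.pos-+ 1 _) (cong (1ℤ +ᶻ_) (ℤP.pos-+ (length V) (hcount L))))
        cancel : ∀ l k s → 1ℤ +ᶻ (l +ᶻ k) -ᶻ s -ᶻ l +ᶻ s ≡ k +ᶻ 1ℤ
        cancel = solve-∀

-- Potentials on the cycle of rows

UnitBounded-sign* : ∀ j {d} → UnitBounded d → UnitBounded (sign j *ᶻ d)
UnitBounded-sign* j {d} (-1≤d , d≤1) with sign-±1 j
... | inj₁ eq rewrite eq | ℤP.*-identityˡ d = -1≤d , d≤1
... | inj₂ eq rewrite eq | ℤP.-1*i≡-i d = ℤP.neg-mono-≤ d≤1 , ℤP.neg-mono-≤ -1≤d

UnitBounded-sign : ∀ j → UnitBounded (sign j)
UnitBounded-sign j = subst UnitBounded (ℤP.*-identityʳ (sign j)) (UnitBounded-sign* j (ℤ.-≤+ , ℤ.+≤+ ℕP.≤-refl))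

sign-next : ∀ {r} → sign r ≡ 1ℤ → ∀ i → sign (next r i) ≡ - sign i
sign-next {r} even-r i with next-cases r i
... | inj₁ (1+i≡r , eq) rewrite eq = sym (trans (cong sign 1+i≡r) even-r)
... | inj₂ (_ , eq) rewrite eq = refl

dist : ℕ → ℕ → ℕ
dist r i = i ℕ.⊓ (r ∸ i)

⊓-step : ∀ i b → UnitBounded (suc i ℕ.⊓ b ⊖ i ℕ.⊓ suc b)
⊓-step zero zero = ℤ.-≤+ , ℤ.+≤+ z≤n
⊓-step zero (suc b) = ℤ.-≤+ , ℤ.+≤+ ℕP.≤-refl
⊓-step (suc i) zero rewrite ℕP.⊓-zeroʳ i = ℤ.-≤- z≤n , ℤ.-≤+
⊓-step (suc i) (suc b) = subst UnitBounded (sym (ℤP.[1+m]⊖[1+n]≡m⊖n (suc i ℕ.⊓ b) (i ℕ.⊓ suc b))) (⊓-step i b)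

alternating : ℤ → ℕ → ℤ
alternating K i = K *ᶻ sign i

alternating-bounded : ∀ {r} K → sign r ≡ 1ℤ → ∀ i → i < r → UnitBounded (alternating K i +ᶻ alternating K (next r i))
alternating-bounded {r} K even-r i _ =
  subst UnitBounded (sym (trans (cong (λ s → K *ᶻ sign i +ᶻ K *ᶻ s) (sign-next {r} even-r i)) (cancel K (sign i))))
        (ℤ.-≤+ , ℤ.+≤+ z≤n)
  where
  cancel : ∀ K s → K *ᶻ s +ᶻ K *ᶻ (- s) ≡ 0ℤ
  cancel = solve-∀

tent : ℕ → ℕ → ℤ
tent r i = - (sign i *ᶻ + dist r i)

tent-bounded : ∀ {r} → 2 ≤ r → sign r ≡ 1ℤ → ∀ i → i < r → UnitBounded (tent r i +ᶻ tent r (next r i))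
tent-bounded {r} 2≤r even-r i i<r with next-cases r i
... | inj₂ (1+i≢r , eq) rewrite eq = subst UnitBounded (sym value) (UnitBounded-sign* i (⊓-step i (r ∸ suc i)))
  where
  open ≡-Reasoning
  rearrange : ∀ s a b → - (s *ᶻ a) +ᶻ - (- s *ᶻ b) ≡ s *ᶻ (b -ᶻ a)
  rearrange = solve-∀
  b = i ℕ.⊓ suc (r ∸ suc i)
  value : tent r i +ᶻ tent r (suc i) ≡ sign i *ᶻ (suc i ℕ.⊓ (r ∸ suc i) ⊖ b)
  value = begin
    tent r i +ᶻ tent r (suc i)                                  ≡⟨ rearrange (sign i) (+ dist r i) (+ dist r (suc i)) ⟩
    sign i *ᶻ (+ dist r (suc i) -ᶻ + dist r i)                  ≡⟨ cong (λ n → sign i *ᶻ (+ dist r (suc i) -ᶻ + (i ℕ.⊓ n)))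
                                                                         (ℕP.+-∸-assoc 1 i<r) ⟩
    sign i *ᶻ (+ dist r (suc i) -ᶻ + (i ℕ.⊓ suc (r ∸ suc i)))   ≡⟨ cong (sign i *ᶻ_) (ℤP.[+m]-[+n]≡m⊖n _ b) ⟩
    sign i *ᶻ (dist r (suc i) ⊖ i ℕ.⊓ suc (r ∸ suc i))          ∎
... | inj₁ (refl , eq) rewrite eq = lemma 2≤r even-r
  where
  lemma : ∀ {i} → 2 ≤ suc i → sign (suc i) ≡ 1ℤ → UnitBounded (tent (suc i) i +ᶻ tent (suc i) 0)
  lemma {suc i} _ even-r = subst UnitBounded (sym value) (ℤ.-≤+ , ℤ.+≤+ ℕP.≤-refl)
    where
    odd-i : sign (suc i) ≡ -1ℤ
    odd-i = trans (sym (ℤP.neg-involutive _)) (cong -_ even-r)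
    dist-last : dist (suc (suc i)) (suc i) ≡ 1
    dist-last = trans (cong (suc i ℕ.⊓_) (ℕP.m+n∸n≡m 1 i)) (cong suc (ℕP.⊓-zeroʳ i))
    value : tent (suc (suc i)) (suc i) +ᶻ tent (suc (suc i)) 0 ≡ 1ℤ
    value = cong₂ (λ s d → - (s *ᶻ + d) +ᶻ - (1ℤ *ᶻ 0ℤ)) odd-i dist-last

descent : ℕ → ℕ → ℤ
descent R i = sign i *ᶻ (+ R -ᶻ + i)

descent-bounded : ∀ R i → i < suc (2 * R) → UnitBounded (descent R i +ᶻ descent R (next (suc (2 * R)) i))
descent-bounded R i i<r with next-cases (suc (2 * R)) i
... | inj₂ (_ , eq) rewrite eq = subst UnitBounded (sym (telescope (sign i) (+ R) (+ i))) (UnitBounded-sign i)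
  where
  telescope : ∀ s R i → s *ᶻ (R -ᶻ i) +ᶻ (- s) *ᶻ (R -ᶻ (1ℤ +ᶻ i)) ≡ s
  telescope = solve-∀
... | inj₁ (1+i≡r , eq) rewrite eq | ℕP.suc-injective 1+i≡r | sign-2* R =
  subst UnitBounded (sym (trans (cong (λ n → 1ℤ *ᶻ (+ R -ᶻ n) +ᶻ 1ℤ *ᶻ (+ R -ᶻ 0ℤ)) 2R≡R+R) (wrap (+ R))))
        (ℤ.-≤+ , ℤ.+≤+ z≤n)
  where
  2R≡R+R : + (2 * R) ≡ + R +ᶻ + R
  2R≡R+R = trans (cong (λ n → + (R + n)) (ℕP.+-identityʳ R)) (ℤP.pos-+ R R)
  wrap : ∀ R → 1ℤ *ᶻ (R -ᶻ (R +ᶻ R)) +ᶻ 1ℤ *ᶻ (R -ᶻ 0ℤ) ≡ 0ℤ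
  wrap = solve-∀

-- Row x lies within N of row 0, going down (distance x) or up (distance r ∸ x) the cycle of rows,
-- at a distance of the same parity as c.
WithinReach : ℕ → ℕ → ℕ → ℕ → Set
WithinReach r c N x = (sign x ≡ sign c × x ≤ N) ⊎ (sign (r ∸ x) ≡ sign c × r ∸ x ≤ N)

module FromCorner {r c x j : ℕ} {rest : List Vertex}
  (hp : HamPath r c ((0 , 0) ∷ rest)) (end : lastOf (0 , 0) rest ≡ (x , j)) where

  steps : ℕ
  steps = hcount ((0 , 0) ∷ rest)

  end<r : x < r
  end<r = proj₁ (All.lookup (proj₁ hp) (subst (_∈ (0 , 0) ∷ rest) end (lastOf-∈ (0 , 0) rest)))

  bound : (h : ℕ → ℤ) → (∀ i → i < r → UnitBounded (h i +ᶻ h (next r i))) →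
          ∀ {n} → h 0 +ᶻ sign j *ᶻ h x ≡ + n → n ≤ steps + 1
  bound h bounded {n} value = ℤP.drop‿+≤+ (begin
    + n                                        ≡⟨ sym value ⟩
    h 0 +ᶻ sign j *ᶻ h x                       ≡⟨ cong₂ _+ᶻ_ (sym (ℤP.*-identityˡ (h 0)))
                                                                (cong (Potential.H r h) (sym end)) ⟩
    Potential.H r h (0 , 0) +ᶻ Potential.H r h (lastOf (0 , 0) rest)
                                               ≤⟨ Potential.endpoint-bound r h bounded hp ⟩
    + steps +ᶻ 1ℤ                              ≡⟨ sym (ℤP.pos-+ steps 1) ⟩
    + (steps + 1)                              ∎)
    where open ℤP.≤-Reasoning

  -- The alternating potential with amplitude steps + 1 would otherwise give 2 (steps + 1) ≤ steps + 1.
  even-parity : sign r ≡ 1ℤ → sign x ≡ - sign j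
  even-parity even-r with sign-cases x j
  ... | inj₂ opposite = opposite
  ... | inj₁ same = ⊥-elim (ℕP.m+1+n≰m (suc steps) (subst (suc steps + suc steps ≤_) (ℕP.+-comm steps 1) 2K≤K))
    where
    K : ℤ
    K = + suc steps
    value : alternating K 0 +ᶻ sign j *ᶻ alternating K x ≡ + (suc steps + suc steps)
    value = begin
      K *ᶻ 1ℤ +ᶻ sign j *ᶻ (K *ᶻ sign x)    ≡⟨ cong (λ s → K *ᶻ 1ℤ +ᶻ sign j *ᶻ (K *ᶻ s)) same ⟩
      K *ᶻ 1ℤ +ᶻ sign j *ᶻ (K *ᶻ sign j)    ≡⟨ double K (sign j) ⟩
      K +ᶻ K *ᶻ (sign j *ᶻ sign j)           ≡⟨ cong (λ s → K +ᶻ K *ᶻ s) (sign-sq j) ⟩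
      K +ᶻ K *ᶻ 1ℤ                           ≡⟨ cong (K +ᶻ_) (ℤP.*-identityʳ K) ⟩
      K +ᶻ K                                 ≡⟨ sym (ℤP.pos-+ (suc steps) (suc steps)) ⟩
      + (suc steps + suc steps)              ∎
      where
      open ≡-Reasoning
      double : ∀ K s → K *ᶻ 1ℤ +ᶻ s *ᶻ (K *ᶻ s) ≡ K +ᶻ K *ᶻ (s *ᶻ s)
      double = solve-∀
    2K≤K : suc steps + suc steps ≤ steps + 1
    2K≤K = bound (alternating K) (alternating-bounded K even-r) value

  even-dist : 2 ≤ r → sign r ≡ 1ℤ → dist r x ≤ steps + 1
  even-dist 2≤r even-r = bound (tent r) (tent-bounded 2≤r even-r) value
    where
    D = + dist r x
    value : tent r 0 +ᶻ sign j *ᶻ tent r x ≡ D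
    value = begin
      0ℤ +ᶻ sign j *ᶻ - (sign x *ᶻ D)       ≡⟨ cong (λ s → 0ℤ +ᶻ sign j *ᶻ - (s *ᶻ D)) (even-parity even-r) ⟩
      0ℤ +ᶻ sign j *ᶻ - (- sign j *ᶻ D)     ≡⟨ square (sign j) D ⟩
      sign j *ᶻ sign j *ᶻ D                  ≡⟨ cong (_*ᶻ D) (sign-sq j) ⟩
      1ℤ *ᶻ D                                ≡⟨ ℤP.*-identityˡ D ⟩
      D                                      ∎
      where
      open ≡-Reasoning
      square : ∀ s d → 0ℤ +ᶻ s *ᶻ - (- s *ᶻ d) ≡ s *ᶻ s *ᶻ d
      square = solve-∀

  module Odd {R : ℕ} (odd-r : r ≡ suc (2 * R)) where

    private
      descent-bound : ∀ {n} → descent R 0 +ᶻ sign j *ᶻ descent R x ≡ + n → n ≤ steps + 1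
      descent-bound = bound (descent R) (subst (λ r → ∀ i → i < r → UnitBounded (descent R i +ᶻ descent R (next r i)))
                                               (sym odd-r) (descent-bounded R))
      open ≡-Reasoning

    x≤steps+1 : sign x ≡ - sign j → x ≤ steps + 1
    x≤steps+1 opposite = descent-bound (begin
      1ℤ *ᶻ (+ R -ᶻ 0ℤ) +ᶻ sign j *ᶻ (sign x *ᶻ (+ R -ᶻ + x))     ≡⟨ cong (λ s → descent R 0 +ᶻ sign j *ᶻ (s *ᶻ (+ R -ᶻ + x))) opposite ⟩
      1ℤ *ᶻ (+ R -ᶻ 0ℤ) +ᶻ sign j *ᶻ (- sign j *ᶻ (+ R -ᶻ + x))   ≡⟨ expand (sign j) (+ R) (+ x) ⟩
      + R -ᶻ sign j *ᶻ sign j *ᶻ (+ R -ᶻ + x)                     ≡⟨ cong (λ s → + R -ᶻ s *ᶻ (+ R -ᶻ + x)) (sign-sq j) ⟩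
      + R -ᶻ 1ℤ *ᶻ (+ R -ᶻ + x)                                   ≡⟨ cancel (+ R) (+ x) ⟩
      + x                                                         ∎)
      where
      expand : ∀ s R x → 1ℤ *ᶻ (R -ᶻ 0ℤ) +ᶻ s *ᶻ (- s *ᶻ (R -ᶻ x)) ≡ R -ᶻ s *ᶻ s *ᶻ (R -ᶻ x)
      expand = solve-∀
      cancel : ∀ R x → R -ᶻ 1ℤ *ᶻ (R -ᶻ x) ≡ x
      cancel = solve-∀

    2R∸x≤steps+1 : sign x ≡ sign j → 2 * R ∸ x ≤ steps + 1
    2R∸x≤steps+1 same = descent-bound (begin
      1ℤ *ᶻ (+ R -ᶻ 0ℤ) +ᶻ sign j *ᶻ (sign x *ᶻ (+ R -ᶻ + x))     ≡⟨ cong (λ s → descent R 0 +ᶻ sign j *ᶻ (s *ᶻ (+ R -ᶻ + x))) same ⟩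
      1ℤ *ᶻ (+ R -ᶻ 0ℤ) +ᶻ sign j *ᶻ (sign j *ᶻ (+ R -ᶻ + x))     ≡⟨ expand (sign j) (+ R) (+ x) ⟩
      + R +ᶻ sign j *ᶻ sign j *ᶻ (+ R -ᶻ + x)                     ≡⟨ cong (λ s → + R +ᶻ s *ᶻ (+ R -ᶻ + x)) (sign-sq j) ⟩
      + R +ᶻ 1ℤ *ᶻ (+ R -ᶻ + x)                                   ≡⟨ collect (+ R) (+ x) ⟩
      + R +ᶻ + R -ᶻ + x                                           ≡⟨ cong (_-ᶻ + x) (sym (ℤP.pos-+ R R)) ⟩
      + (R + R) -ᶻ + x                                            ≡⟨ cong (λ n → + (R + n) -ᶻ + x) (sym (ℕP.+-identityʳ R)) ⟩
      + (2 * R) -ᶻ + x                                            ≡⟨ ℤP.[+m]-[+n]≡m⊖n (2 * R) x ⟩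
      2 * R ⊖ x                                                   ≡⟨ ℤP.⊖-≥ (ℕP.≤-pred (subst (x <_) odd-r end<r)) ⟩
      + (2 * R ∸ x)                                               ∎)
      where
      expand : ∀ s R x → 1ℤ *ᶻ (R -ᶻ 0ℤ) +ᶻ s *ᶻ (s *ᶻ (R -ᶻ x)) ≡ R +ᶻ s *ᶻ s *ᶻ (R -ᶻ x)
      expand = solve-∀
      collect : ∀ R x → R +ᶻ 1ℤ *ᶻ (R -ᶻ x) ≡ R +ᶻ R -ᶻ x
      collect = solve-∀

  within-reach : 2 ≤ r → ∀ {N} → steps + 1 ≤ N → sign N ≡ - sign j → WithinReach r (suc j) N x
  within-reach 2≤r {N} steps<N sign-N with sign-±1 r
  ... | inj₁ even-r with ℕP.⊓-sel x (r ∸ x)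
  ...   | inj₁ dist≡x = inj₁ (even-parity even-r , subst (_≤ N) dist≡x (ℕP.≤-trans (even-dist 2≤r even-r) steps<N))
  ...   | inj₂ dist≡r-x = inj₂ (sign-r∸x , subst (_≤ N) dist≡r-x (ℕP.≤-trans (even-dist 2≤r even-r) steps<N))
    where
    sign-r∸x : sign (r ∸ x) ≡ - sign j
    sign-r∸x = trans (sign-∸ (ℕP.<⇒≤ end<r))
                     (trans (cong (_*ᶻ sign x) even-r) (trans (ℤP.*-identityˡ (sign x)) (even-parity even-r)))
  within-reach 2≤r {N} steps<N sign-N | inj₂ odd-r with sign≡-1⇒odd r odd-r | sign-cases x j
  ... | R , odd-r′ | inj₂ opposite = inj₁ (opposite , ℕP.≤-trans (Odd.x≤steps+1 {R} odd-r′ opposite) steps<N)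
  ... | R , odd-r′ | inj₁ same = inj₂ (sign-r∸x , ≤-pred-by-sign (trans sign-r∸x (sym sign-N)) r∸x≤1+N)
    where
    sign-r∸x : sign (r ∸ x) ≡ - sign j
    sign-r∸x = trans (sign-∸ (ℕP.<⇒≤ end<r))
                     (trans (cong (_*ᶻ sign x) odd-r) (trans (ℤP.-1*i≡-i (sign x)) (cong -_ same)))
    r∸x≤1+N : r ∸ x ≤ suc N
    r∸x≤1+N = subst (_≤ suc N) (trans (sym (ℕP.+-∸-assoc 1 (ℕP.≤-pred (subst (x <_) odd-r′ end<r))))
                                      (cong (_∸ x) (sym odd-r′)))
                    (s≤s (ℕP.≤-trans (Odd.2R∸x≤steps+1 {R} odd-r′ same) steps<N))

-- Column sweeps

range : ℕ → ℕ → List ℕ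
range a zero = []
range a (suc n) = a ∷ range (suc a) n

∈-range⁻ : ∀ {a n i} → i ∈ range a n → a ≤ i × i < a + n
∈-range⁻ {a} {suc n} (here refl) = ℕP.≤-refl , ℕP.m<m+n a (s≤s z≤n)
∈-range⁻ {a} {suc n} {i} (there i∈) with ∈-range⁻ {suc a} {n} i∈
... | a<i , i<a+1+n = ℕP.<⇒≤ a<i , subst (i <_) (sym (ℕP.+-suc a n)) i<a+1+n

∈-range⁺ : ∀ {a n i} → a ≤ i → i < a + n → i ∈ range a n
∈-range⁺ {a} {zero} a≤i i<a+0 = ⊥-elim (ℕP.<-irrefl refl (ℕP.<-≤-trans i<a+0 (subst (_≤ _) (sym (ℕP.+-identityʳ a)) a≤i)))
∈-range⁺ {a} {suc n} {i} a≤i i<a+1+n with a ℕ.≟ i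
... | yes refl = here refl
... | no a≢i = there (∈-range⁺ (ℕP.≤∧≢⇒< a≤i a≢i) (subst (i <_) (ℕP.+-suc a n) i<a+1+n))

range-unique : ∀ a n → Unique (range a n)
range-unique a zero = []
range-unique a (suc n) = All.tabulate (λ i∈ a≡i → ℕP.<-irrefl a≡i (proj₁ (∈-range⁻ i∈))) ∷ range-unique (suc a) n

range-linked : ∀ {r} a n → Linked (RowAdj r) (range a n)
range-linked a zero = []
range-linked a (suc zero) = [-]
range-linked a (suc (suc n)) = inj₁ (inj₁ refl) ∷ range-linked (suc a) (suc n)

lastOf-range : ∀ a n → lastOf a (range (suc a) n) ≡ a + n
lastOf-range a zero = sym (ℕP.+-identityʳ a)
lastOf-range a (suc n) = trans (lastOf-range (suc a) n) (sym (ℕP.+-suc a n))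

upTo≡range : ∀ n → upTo n ≡ range 0 n
upTo≡range n = go id 0 n (λ _ → refl)
  where
  go : ∀ (f : ℕ → ℕ) a n → (∀ k → f k ≡ a + k) → Data.List.applyUpTo f n ≡ range a n
  go f a zero _ = refl
  go f a (suc n) f≗a+ = cong₂ _∷_ (trans (f≗a+ 0) (ℕP.+-identityʳ a))
                                  (go (f ∘ suc) (suc a) n (λ k → trans (f≗a+ (suc k)) (ℕP.+-suc a k)))

record IsRowTour (r : ℕ) (R : List ℕ) (y z : ℕ) : Set where
  field
    rest     : List ℕ
    starts   : R ≡ y ∷ rest
    ends     : lastOf y rest ≡ z
    unique   : Unique R
    bounded  : All (_< r) R
    complete : ∀ i → i < r → i ∈ R
    linked   : Linked (RowAdj r) R

ascending : ℕ → ℕ → List ℕ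
ascending r y = range y (r ∸ y) ++ range 0 y

ascending-ends : ∀ {r} y → y < r → ∃[ rest ] (ascending r y ≡ y ∷ rest × lastOf y rest ≡ prev r y)
ascending-ends {suc d} zero _ =
  range 1 d ++ [] , refl , trans (cong (lastOf 0) (ListP.++-identityʳ (range 1 d))) (lastOf-range 0 d)
ascending-ends {r} (suc y) y<r with r ∸ suc y in eq
... | zero = ⊥-elim (ℕP.m>n⇒m∸n≢0 y<r eq)
... | suc d = range (suc (suc y)) d ++ range 0 (suc y) , refl
            , trans (lastOf-++ (suc y) (range (suc (suc y)) d) 0 (range 1 y)) (lastOf-range 0 y)

ascending-tour : ∀ {r y} → y < r → IsRowTour r (ascending r y) y (prev r y)
ascending-tour {r} {y} y<r = record
  { rest = proj₁ (ascending-ends y y<r)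
  ; starts = proj₁ (proj₂ (ascending-ends y y<r))
  ; ends = proj₂ (proj₂ (ascending-ends y y<r))
  ; unique = Unique.++⁺ (range-unique y (r ∸ y)) (range-unique 0 y) disjoint
  ; bounded = All.tabulate (λ i∈ → [ (λ i∈₁ → subst (_ <_) y+[r∸y]≡r (proj₂ (∈-range⁻ i∈₁)))
                                   , (λ i∈₂ → ℕP.<-trans (proj₂ (∈-range⁻ i∈₂)) y<r) ]′ (∈-++⁻ (range y (r ∸ y)) i∈))
  ; complete = complete
  ; linked = linked y y<r
  }
  where
  y+[r∸y]≡r : y + (r ∸ y) ≡ r
  y+[r∸y]≡r = ℕP.m+[n∸m]≡n (ℕP.<⇒≤ y<r)
  disjoint : ∀ {i} → ¬ (i ∈ range y (r ∸ y) × i ∈ range 0 y)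
  disjoint (i∈₁ , i∈₂) = ℕP.<-irrefl refl (ℕP.<-≤-trans (proj₂ (∈-range⁻ i∈₂)) (proj₁ (∈-range⁻ i∈₁)))
  complete : ∀ i → i < r → i ∈ ascending r y
  complete i i<r with y ℕ.≤? i
  ... | yes y≤i = ∈-++⁺ˡ (∈-range⁺ y≤i (subst (i <_) (sym y+[r∸y]≡r) i<r))
  ... | no y≰i = ∈-++⁺ʳ (range y (r ∸ y)) (∈-range⁺ z≤n (ℕP.≰⇒> y≰i))
  linked : ∀ y → y < r → Linked (RowAdj r) (ascending r y)
  linked zero _ = subst (Linked (RowAdj r)) (sym (ListP.++-identityʳ _)) (range-linked 0 r)
  linked (suc y) y<r with r ∸ suc y in eq
  ... | zero = ⊥-elim (ℕP.m>n⇒m∸n≢0 y<r eq)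
  ... | suc d = Linked-++ (range-linked (suc y) (suc d)) wraps (range-linked 0 (suc y))
    where
    wraps : RowAdj r (lastOf (suc y) (range (suc (suc y)) d)) 0
    wraps = inj₁ (inj₂ (trans (cong suc (lastOf-range (suc y) d))
                        (trans (sym (ℕP.+-suc (suc y) d))
                               (trans (cong (λ n → suc y + n) (sym eq)) (ℕP.m+[n∸m]≡n (ℕP.<⇒≤ y<r)))) , refl))

map-reflect-involutive : ∀ {r} xs → All (_< r) xs → map (reflect r) (map (reflect r) xs) ≡ xs
map-reflect-involutive [] _ = refl
map-reflect-involutive (x ∷ xs) (x<r ∷ xs<r) = cong₂ _∷_ (reflect-involutive x<r) (map-reflect-involutive xs xs<r)

IsRowTour-reflect : ∀ {r R y z} → IsRowTour r R y z → IsRowTour r (map (reflect r) R) (reflect r y) (reflect r z)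
IsRowTour-reflect {r} {R} {y} T = record
  { rest = map (reflect r) rest
  ; starts = cong (map (reflect r)) starts
  ; ends = trans (lastOf-map (reflect r) y rest) (cong (reflect r) ends)
  ; unique = Unique.map⁻ (subst Unique (sym (map-reflect-involutive R bounded)) unique)
  ; bounded = All.map⁺ (All.map reflect-< bounded)
  ; complete = λ i i<r → subst (_∈ map (reflect r) R) (reflect-involutive i<r)
                               (∈-map⁺ (reflect r) (complete (reflect r i) (reflect-< i<r)))
  ; linked = Linked-map (reflect r) reflect-RowAdj bounded linked
  }
  where open IsRowTour T

descending : ℕ → ℕ → List ℕ
descending r y = map (reflect r) (ascending r (reflect r y))

descending-tour : ∀ {r y} → y < r → IsRowTour r (descending r y) y (next r y)
descending-tour {r} {y} y<r =
  subst₂ (IsRowTour r (descending r y)) (reflect-involutive y<r) reflected-end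
         (IsRowTour-reflect (ascending-tour (reflect-< y<r)))
  where
  w = prev r (reflect r y)
  reflected-end : reflect r w ≡ next r y
  reflected-end = VStep⇒≡next (reflect-< (prev-< (reflect-< y<r)))
                    (subst (λ i → VStep r i (reflect r w)) (reflect-involutive y<r)
                           (reflect-VStep (reflect-< y<r) (subst (VStep r w) (next-prev (reflect-< y<r)) (VStep-next r w))))

column : ℕ → List ℕ → List Vertex
column j = map (_, j)

hcount-column : ∀ j R → hcount (column j R) ≡ 0
hcount-column j [] = refl
hcount-column j (i ∷ []) = refl
hcount-column j (i ∷ i′ ∷ R) = trans (cong (λ b → (if b then 0 else 1) + hcount (column j (i′ ∷ R))) (≡ᵇ-refl j))
                                     (hcount-column j (i′ ∷ R))

column-inGrid : ∀ {r j R} → All (_< r) R → All (InGrid r (suc j)) (column j R)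
column-inGrid {j = j} R<r = All.map⁺ (All.map (_, ℕP.n<1+n j) R<r)

column-linked : ∀ {r j R} → Linked (RowAdj r) R → Linked (Adj r) (column j R)
column-linked = Linked-map _ (λ _ _ adj → inj₂ (refl , adj)) (All.universal (λ _ → Data.Unit.tt) _)

column-unique : ∀ {j R} → Unique R → Unique (column j R)
column-unique = Unique.map⁺ (cong proj₁)

append-column : ∀ {r j a xs y z R} → HamPath r (suc j) (a ∷ xs) → lastOf a xs ≡ (y , j) → IsRowTour r R y z →
  HamPath r (suc (suc j)) ((a ∷ xs) ++ column (suc j) R) ×
  lastOf a (xs ++ column (suc j) R) ≡ (z , suc j) ×
  hcount ((a ∷ xs) ++ column (suc j) R) ≡ suc (hcount (a ∷ xs))
append-column {r} {j} {a} {xs} {y} {z} (inGrid , unique , covers , linked) end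
              record { rest = rest ; starts = refl ; ends = ends ; unique = uniqueR ; bounded = bounded
                     ; complete = complete ; linked = linkedR } =
  (inGrid′ , unique′ , covers′ , linked′) , end′ , hcount′
  where
  P = a ∷ xs
  C = column (suc j) (y ∷ rest)
  inGrid′ : All (InGrid r (suc (suc j))) (P ++ C)
  inGrid′ = All.++⁺ (All.map (Product.map₂ (ℕP.m≤n⇒m≤1+n)) inGrid) (column-inGrid bounded)
  unique′ : Unique (P ++ C)
  unique′ = Unique.++⁺ unique (column-unique uniqueR) disjoint
    where
    disjoint : ∀ {v} → ¬ (v ∈ P × v ∈ C)
    disjoint (v∈P , v∈C) with ∈-map⁻ (_, suc j) v∈C
    ... | _ , _ , refl = ℕP.<-irrefl refl (proj₂ (All.lookup inGrid v∈P))
  covers′ : ∀ v → InGrid r (suc (suc j)) v → v ∈ P ++ C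
  covers′ (i , k) (i<r , k<2+j) with k ℕ.≟ suc j
  ... | yes refl = ∈-++⁺ʳ P (∈-map⁺ (_, suc j) (complete i i<r))
  ... | no k≢1+j = ∈-++⁺ˡ (covers (i , k) (i<r , ℕP.≤∧≢⇒< (ℕP.≤-pred k<2+j) k≢1+j))
  linked′ : Linked (Adj r) (P ++ C)
  linked′ = Linked-++ linked (subst (λ w → Adj r w (y , suc j)) (sym end) (inj₁ (refl , inj₁ refl))) (column-linked linkedR)
  end′ : lastOf a (xs ++ C) ≡ (z , suc j)
  end′ = trans (lastOf-++ a xs (y , suc j) (column (suc j) rest))
               (trans (lastOf-map (_, suc j) y rest) (cong (_, suc j) ends))
  hcount′ : hcount (P ++ C) ≡ suc (hcount P)
  hcount′ rewrite hcount-++ a xs (y , suc j) (column (suc j) rest) | end | ≡ᵇ-suc j | hcount-column (suc j) (y ∷ rest) =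
    ℕP.+-comm (hcount P) 1

tourRows : ℕ → Bool → ℕ → List ℕ
tourRows r true = ascending r
tourRows r false = descending r

tourEnd : ℕ → Bool → ℕ → ℕ
tourEnd r true = prev r
tourEnd r false = next r

tourRows-tour : ∀ {r} b {y} → y < r → IsRowTour r (tourRows r b y) y (tourEnd r b y)
tourRows-tour true = ascending-tour
tourRows-tour false = descending-tour

tourEnd-< : ∀ {r} b {y} → y < r → tourEnd r b y < r
tourEnd-< true = prev-<
tourEnd-< false = next-<

sweep : ℕ → ℕ → ℕ → List Bool → List Vertex
sweep r y j [] = []
sweep r y j (b ∷ bs) = column j (tourRows r b y) ++ sweep r (tourEnd r b y) (suc j) bs

sweepEnd : ℕ → ℕ → List Bool → ℕ
sweepEnd r y [] = y
sweepEnd r y (b ∷ bs) = sweepEnd r (tourEnd r b y) bs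

append-sweep : ∀ bs {r j a xs y} → y < r → HamPath r (suc j) (a ∷ xs) → lastOf a xs ≡ (y , j) →
  let S = sweep r y (suc j) bs in
  HamPath r (length bs + suc j) ((a ∷ xs) ++ S) ×
  lastOf a (xs ++ S) ≡ (sweepEnd r y bs , length bs + j) ×
  hcount ((a ∷ xs) ++ S) ≡ length bs + hcount (a ∷ xs)
append-sweep [] {r} {j} {a} {xs} _ hp end =
  subst (HamPath r (suc j)) (sym (ListP.++-identityʳ (a ∷ xs))) hp ,
  trans (cong (lastOf a) (ListP.++-identityʳ xs)) end ,
  cong hcount (ListP.++-identityʳ (a ∷ xs))
append-sweep (b ∷ bs) {r} {j} {a} {xs} {y} y<r hp end
  with append-column hp end (tourRows-tour b y<r)
... | hp₁ , end₁ , hcount₁ with append-sweep bs (tourEnd-< b y<r) hp₁ end₁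
... | hp₂ , end₂ , hcount₂ =
  subst₂ (HamPath r) (ℕP.+-suc (length bs) (suc j)) reassoc hp₂ ,
  trans (cong (lastOf a) (sym (ListP.++-assoc xs C S)))
        (trans end₂ (cong (sweepEnd r (tourEnd r b y) bs ,_) (ℕP.+-suc (length bs) j))) ,
  trans (cong hcount (sym reassoc)) (trans hcount₂ (trans (cong (_+_ (length bs)) hcount₁) (ℕP.+-suc (length bs) _)))
  where
  C = column (suc j) (tourRows r b y)
  S = sweep r (tourEnd r b y) (suc (suc j)) bs
  reassoc : ((a ∷ xs) ++ C) ++ S ≡ (a ∷ xs) ++ C ++ S
  reassoc = ListP.++-assoc (a ∷ xs) C S

ColumnsFrom : ℕ → List Vertex → Set
ColumnsFrom j L = Linked _≤_ (j ∷ map col L)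

ColumnsFrom-weaken : ∀ {j L} → ColumnsFrom (suc j) L → ColumnsFrom j L
ColumnsFrom-weaken {L = []} _ = [-]
ColumnsFrom-weaken {L = _ ∷ _} (j<c ∷ cs) = ℕP.<⇒≤ j<c ∷ cs

ColumnsFrom-column : ∀ {j L} R → ColumnsFrom (suc j) L → ColumnsFrom j (column j R ++ L)
ColumnsFrom-column [] cs = ColumnsFrom-weaken cs
ColumnsFrom-column (i ∷ R) cs = ℕP.≤-refl ∷ ColumnsFrom-column R cs

ColumnsFrom-sweep : ∀ r y j bs → ColumnsFrom j (sweep r y j bs)
ColumnsFrom-sweep r y j [] = [-]
ColumnsFrom-sweep r y j (b ∷ bs) = ColumnsFrom-column (tourRows r b y) (ColumnsFrom-sweep r (tourEnd r b y) (suc j) bs)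

-- GG paths

Form1Path : ℕ → ℕ → ℕ → ℕ → Set
Form1Path r c m t = ∃[ k ] ∃[ Q ] ∃[ S ]
  (HamPath r c Q × 2 * k + 1 ≤ r × Q ≡ prefix1 r k ++ S × ColumnsFrom 1 S ×
   hcount Q ≤ 2 * m + (c ∸ 1) × ∃[ init ] Q ≡ init ∷ʳ (t , c ∸ 1))

form1-path : ∀ {r c m t} k S a xs → HamPath r c (a ∷ xs) → lastOf a xs ≡ (t , c ∸ 1) → 2 * k + 1 ≤ r →
             a ∷ xs ≡ prefix1 r k ++ S → ColumnsFrom 1 S → hcount (a ∷ xs) ≤ 2 * m + (c ∸ 1) → Form1Path r c m t
form1-path k S a xs hp end k<r shape columns few =
  k , a ∷ xs , S , hp , k<r , shape , columns , few , Product.map₂ (λ eq → trans eq (cong (_ ∷ʳ_) end)) (∷-≡-∷ʳ-lastOf a xs)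

Form1Path⇒InA : ∀ {r c m t} → Form1Path r c m t → InA r c m t
Form1Path⇒InA (k , Q , S , hp , k<r , shape , columns , few , ends) =
  k , Q , (hp , k<r , S , inj₁ shape , columns) , few , ends

column-hamPath : ∀ {r R y z} → IsRowTour r R y z → HamPath r 1 (column 0 R)
column-hamPath {r} {R} T = column-inGrid bounded , column-unique unique , covers , column-linked linked
  where
  open IsRowTour T
  covers : ∀ v → InGrid r 1 v → v ∈ column 0 R
  covers (i , .0) (i<r , s≤s z≤n) = ∈-map⁺ (_, 0) (complete i i<r)

prefix1-zero : ∀ r′ S → column 0 (ascending (suc r′) 0) ++ (r′ , 1) ∷ S ≡ prefix1 (suc r′) 0 ++ S
prefix1-zero r′ S = begin
  column 0 (ascending (suc r′) 0) ++ (r′ , 1) ∷ S   ≡⟨ cong (λ R → column 0 R ++ (r′ , 1) ∷ S) rows ⟩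
  column 0 (upTo r′ ∷ʳ r′) ++ (r′ , 1) ∷ S          ≡⟨ cong (_++ (r′ , 1) ∷ S) (ListP.map-++ (_, 0) (upTo r′) (r′ ∷ [])) ⟩
  (column 0 (upTo r′) ++ (r′ , 0) ∷ []) ++ (r′ , 1) ∷ S  ≡⟨ ListP.++-assoc (column 0 (upTo r′)) _ _ ⟩
  column 0 (upTo r′) ++ (r′ , 0) ∷ (r′ , 1) ∷ S     ≡⟨ sym (ListP.++-assoc (column 0 (upTo r′)) _ S) ⟩
  prefix1 (suc r′) 0 ++ S                           ∎
  where
  open ≡-Reasoning
  rows : ascending (suc r′) 0 ≡ upTo r′ ∷ʳ r′
  rows = trans (ListP.++-identityʳ _) (trans (sym (upTo≡range (suc r′))) (sym (ListP.upTo-∷ʳ r′)))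

form1-corner-sweep : ∀ m r′ bs → 1 ≤ length bs → Form1Path (suc r′) (suc (length bs)) m (sweepEnd (suc r′) r′ bs)
form1-corner-sweep m r′ (b ∷ bs) _ with append-sweep (b ∷ bs) (ℕP.n<1+n r′) (column-hamPath T₀) end₀
  where
  T₀ = ascending-tour {suc r′} {0} (s≤s z≤n)
  end₀ : lastOf (0 , 0) (column 0 (range 1 r′ ++ [])) ≡ (r′ , 0)
  end₀ = trans (lastOf-map (_, 0) 0 (range 1 r′ ++ [])) (cong (_, 0) (IsRowTour.ends T₀))
... | hp , end , hcount≡ =
  form1-path {m = m} 0 S (0 , 0) (column 0 (range 1 r′ ++ []) ++ sweep r r′ 1 (b ∷ bs))
    (subst (λ c → HamPath r c (column 0 (ascending r 0) ++ sweep r r′ 1 (b ∷ bs))) (ℕP.+-comm n 1) hp)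
    (trans end (cong (sweepEnd r r′ (b ∷ bs) ,_) (ℕP.+-identityʳ n))) (s≤s z≤n)
    shape (ColumnsFrom-column (IsRowTour.rest tour) (ColumnsFrom-sweep r (tourEnd r b r′) 2 bs))
    (subst (_≤ 2 * m + n) (sym (trans hcount≡ (trans (cong (_+_ n) (hcount-column 0 (ascending r 0))) (ℕP.+-identityʳ n))))
           (ℕP.m≤n+m n (2 * m)))
  where
  r = suc r′
  n = length (b ∷ bs)
  tour = tourRows-tour b (ℕP.n<1+n r′)
  S = column 1 (IsRowTour.rest tour) ++ sweep r (tourEnd r b r′) 2 bs
  shape : column 0 (ascending r 0) ++ sweep r r′ 1 (b ∷ bs) ≡ prefix1 r 0 ++ S
  shape = trans (cong (λ R → column 0 (ascending r 0) ++ column 1 R ++ sweep r (tourEnd r b r′) 2 bs)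
                      (IsRowTour.starts tour))
                (prefix1-zero r′ S)

zz-∈⁻ : ∀ {a n b v} → v ∈ zz a n b → a ≤ row v × row v < a + n × col v ≤ 1
zz-∈⁻ {a} {suc n} {true} (here refl) = ℕP.≤-refl , ℕP.m<m+n a (s≤s z≤n) , z≤n
zz-∈⁻ {a} {suc n} {true} (there (here refl)) = ℕP.≤-refl , ℕP.m<m+n a (s≤s z≤n) , s≤s z≤n
zz-∈⁻ {a} {suc n} {false} (here refl) = ℕP.≤-refl , ℕP.m<m+n a (s≤s z≤n) , s≤s z≤n
zz-∈⁻ {a} {suc n} {false} (there (here refl)) = ℕP.≤-refl , ℕP.m<m+n a (s≤s z≤n) , z≤n
zz-∈⁻ {a} {suc n} {true} {v} (there (there v∈)) with zz-∈⁻ {suc a} {n} {false} v∈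
... | a<i , i<1+a+n , j≤1 = ℕP.<⇒≤ a<i , subst (row v <_) (sym (ℕP.+-suc a n)) i<1+a+n , j≤1
zz-∈⁻ {a} {suc n} {false} {v} (there (there v∈)) with zz-∈⁻ {suc a} {n} {true} v∈
... | a<i , i<1+a+n , j≤1 = ℕP.<⇒≤ a<i , subst (row v <_) (sym (ℕP.+-suc a n)) i<1+a+n , j≤1

zz-∈⁺ : ∀ {a n b i j} → a ≤ i → i < a + n → j ≤ 1 → (i , j) ∈ zz a n b
zz-∈⁺ {a} {zero} {b} {i} a≤i i<a+0 _ =
  ⊥-elim (ℕP.<-irrefl refl (ℕP.<-≤-trans i<a+0 (subst (_≤ i) (sym (ℕP.+-identityʳ a)) a≤i)))
zz-∈⁺ {a} {suc n} {b} {i} {j} a≤i i<a+1+n j≤1 with a ℕ.≟ i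
zz-∈⁺ {a} {suc n} {true} {.a} {zero} _ _ _ | yes refl = here refl
zz-∈⁺ {a} {suc n} {true} {.a} {suc zero} _ _ _ | yes refl = there (here refl)
zz-∈⁺ {a} {suc n} {false} {.a} {zero} _ _ _ | yes refl = there (here refl)
zz-∈⁺ {a} {suc n} {false} {.a} {suc zero} _ _ _ | yes refl = here refl
zz-∈⁺ {a} {suc n} {_} {.a} {suc (suc _)} _ _ (s≤s ()) | yes refl
zz-∈⁺ {a} {suc n} {true} {i} a≤i i<a+1+n j≤1 | no a≢i =
  there (there (zz-∈⁺ (ℕP.≤∧≢⇒< a≤i a≢i) (subst (i <_) (ℕP.+-suc a n) i<a+1+n) j≤1))
zz-∈⁺ {a} {suc n} {false} {i} a≤i i<a+1+n j≤1 | no a≢i =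
  there (there (zz-∈⁺ (ℕP.≤∧≢⇒< a≤i a≢i) (subst (i <_) (ℕP.+-suc a n) i<a+1+n) j≤1))

zz-unique : ∀ a n b → Unique (zz a n b)
zz-unique a zero b = []
zz-unique a (suc n) true = ((λ ()) ∷ later) ∷ later ∷ zz-unique (suc a) n false
  where
  later : ∀ {j} → All ((a , j) ≢_) (zz (suc a) n false)
  later = All.tabulate (λ v∈ eq → ℕP.<-irrefl (cong proj₁ eq) (proj₁ (zz-∈⁻ v∈)))
zz-unique a (suc n) false = ((λ ()) ∷ later) ∷ later ∷ zz-unique (suc a) n true
  where
  later : ∀ {j} → All ((a , j) ≢_) (zz (suc a) n true)
  later = All.tabulate (λ v∈ eq → ℕP.<-irrefl (cong proj₁ eq) (proj₁ (zz-∈⁻ v∈)))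

zz-linked : ∀ r a n b → Linked (Adj r) (zz a n b)
zz-linked r a zero b = []
zz-linked r a (suc zero) true = inj₁ (refl , inj₁ refl) ∷ [-]
zz-linked r a (suc zero) false = inj₁ (refl , inj₂ refl) ∷ [-]
zz-linked r a (suc (suc n)) true =
  inj₁ (refl , inj₁ refl) ∷ inj₂ (refl , inj₁ (inj₁ refl)) ∷ zz-linked r (suc a) (suc n) false
zz-linked r a (suc (suc n)) false =
  inj₁ (refl , inj₂ refl) ∷ inj₂ (refl , inj₁ (inj₁ refl)) ∷ zz-linked r (suc a) (suc n) true

zz-hcount : ∀ a n b → hcount (zz a (suc n) b) ≡ suc n
zz-hcount a zero true = refl
zz-hcount a zero false = refl
zz-hcount a (suc n) true = cong suc (zz-hcount (suc a) n false)
zz-hcount a (suc n) false = cong suc (zz-hcount (suc a) n true)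

zz-lastOf : ∀ d a k → lastOf d (zz a (suc (2 * k)) true) ≡ (a + 2 * k , 1)
zz-lastOf d a zero = cong (_, 1) (sym (ℕP.+-identityʳ a))
zz-lastOf d a (suc k) = begin
  lastOf d (zz a (suc (2 * suc k)) true)                  ≡⟨ cong (λ n → lastOf d (zz a (suc n) true)) (ℕP.*-suc 2 k) ⟩
  lastOf (suc a , 0) (zz (suc (suc a)) (suc (2 * k)) true) ≡⟨ zz-lastOf (suc a , 0) (suc (suc a)) k ⟩
  (suc (suc a) + 2 * k , 1)                               ≡⟨ cong (_, 1) (sym a+2[1+k]) ⟩
  (a + 2 * suc k , 1)                                     ∎
  where
  open ≡-Reasoning
  a+2[1+k] : a + 2 * suc k ≡ suc (suc a) + 2 * k
  a+2[1+k] = trans (cong (_+_ a) (ℕP.*-suc 2 k)) (trans (ℕP.+-suc a _) (cong suc (ℕP.+-suc a _)))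

module ZigzagPrefix (a′ k : ℕ) where
  a = suc a′
  n = suc (2 * k)
  r = a + n
  top₀ = column 0 (range 0 a)
  zig = zz a n true
  top₁ = column 1 (range 0 a)

  path : List Vertex
  path = (top₀ ++ zig) ++ top₁

  path≡prefix1 : top₀ ++ zig ≡ prefix1 r k
  path≡prefix1 = sym (trans (cong (λ b → column 0 (upTo b) ++ zz b n true) (ℕP.m+n∸n≡m a n))
                            (cong (λ R → column 0 R ++ zig) (upTo≡range a)))

  private
    range-< : All (_< r) (range 0 a)
    range-< = All.tabulate (λ i∈ → ℕP.<-≤-trans (proj₂ (∈-range⁻ i∈)) (ℕP.m≤m+n a n))

    ∈-top : ∀ {v j} → v ∈ column j (range 0 a) → row v < a
    ∈-top v∈ with ∈-map⁻ (_, _) v∈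
    ... | _ , i∈ , refl = proj₂ (∈-range⁻ i∈)

    end₀ : lastOf (0 , 0) (column 0 (range 1 a′)) ≡ (a′ , 0)
    end₀ = trans (lastOf-map (_, 0) 0 (range 1 a′)) (cong (_, 0) (lastOf-range 0 a′))

    end₁ : lastOf (0 , 0) (column 0 (range 1 a′) ++ zig) ≡ (a + 2 * k , 1)
    end₁ = trans (lastOf-++ (0 , 0) (column 0 (range 1 a′)) (a , 0) _) (zz-lastOf (a , 0) a k)

  path-end : lastOf (0 , 0) ((column 0 (range 1 a′) ++ zig) ++ top₁) ≡ (a′ , 1)
  path-end = trans (lastOf-++ (0 , 0) (column 0 (range 1 a′) ++ zig) (0 , 1) (column 1 (range 1 a′)))
                   (trans (lastOf-map (_, 1) 0 (range 1 a′)) (cong (_, 1) (lastOf-range 0 a′)))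

  path-hcount : hcount path ≡ n
  path-hcount = begin
    hcount path
      ≡⟨ hcount-++ (0 , 0) (column 0 (range 1 a′) ++ zig) (0 , 1) (column 1 (range 1 a′)) ⟩
    hcount (top₀ ++ zig) + ((if col (lastOf (0 , 0) (column 0 (range 1 a′) ++ zig)) ℕ.≡ᵇ 1 then 0 else 1) + hcount top₁)
      ≡⟨ cong₂ (λ h v → h + ((if col v ℕ.≡ᵇ 1 then 0 else 1) + hcount top₁)) zig-hcount end₁ ⟩
    n + hcount top₁
      ≡⟨ trans (cong (_+_ n) (hcount-column 1 (range 0 a))) (ℕP.+-identityʳ n) ⟩
    n ∎
    where
    open ≡-Reasoning
    zig-hcount : hcount (top₀ ++ zig) ≡ n
    zig-hcount = trans (hcount-++ (0 , 0) (column 0 (range 1 a′)) (a , 0) _)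
                       (trans (cong (λ v → hcount top₀ + ((if col v ℕ.≡ᵇ 0 then 0 else 1) + hcount zig)) end₀)
                              (trans (cong (λ h → h + hcount zig) (hcount-column 0 (range 0 a))) (zz-hcount a (2 * k) true)))

  path-hamPath : HamPath r 2 path
  path-hamPath = inGrid , unique , covers , linked
    where
    inGrid : All (InGrid r 2) path
    inGrid = All.++⁺ (All.++⁺ (All.map (Product.map₂ ℕP.m≤n⇒m≤1+n) (column-inGrid range-<))
                               (All.tabulate (λ v∈ → Product.map₂ s≤s (proj₂ (zz-∈⁻ {a} {n} {true} v∈)))))
                     (column-inGrid range-<)
    top₀∩zig : ∀ {v} → ¬ (v ∈ top₀ × v ∈ zig)
    top₀∩zig (v∈₀ , v∈zig) = ℕP.<-irrefl refl (ℕP.<-≤-trans (∈-top v∈₀) (proj₁ (zz-∈⁻ {a} {n} {true} v∈zig)))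
    ∩top₁ : ∀ {v} → ¬ (v ∈ top₀ ++ zig × v ∈ top₁)
    ∩top₁ (v∈ , v∈₁) with ∈-map⁻ (_, 1) v∈₁ | ∈-++⁻ top₀ v∈
    ... | _ , _ , refl | inj₁ v∈₀ with () ← proj₂ (proj₂ (∈-map⁻ (_, 0) v∈₀))
    ... | _ , _ , refl | inj₂ v∈zig = ℕP.<-irrefl refl (ℕP.<-≤-trans (∈-top v∈₁) (proj₁ (zz-∈⁻ {a} {n} {true} v∈zig)))
    unique : Unique path
    unique = Unique.++⁺ (Unique.++⁺ (column-unique (range-unique 0 a)) (zz-unique a n true) top₀∩zig)
                        (column-unique (range-unique 0 a)) ∩top₁
    covers : ∀ v → InGrid r 2 v → v ∈ path
    covers (i , j) (i<r , j<2) with a ℕ.≤? i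
    covers (i , j) (i<r , j<2) | yes a≤i = ∈-++⁺ˡ (∈-++⁺ʳ top₀ (zz-∈⁺ {a} {n} {true} a≤i i<r (ℕP.≤-pred j<2)))
    covers (i , zero) _ | no a≰i = ∈-++⁺ˡ (∈-++⁺ˡ (∈-map⁺ (_, 0) (∈-range⁺ z≤n (ℕP.≰⇒> a≰i))))
    covers (i , suc zero) _ | no a≰i = ∈-++⁺ʳ (top₀ ++ zig) (∈-map⁺ (_, 1) (∈-range⁺ z≤n (ℕP.≰⇒> a≰i)))
    covers (i , suc (suc j)) (_ , s≤s (s≤s ())) | no _
    linked : Linked (Adj r) path
    linked = Linked-++ (Linked-++ (column-linked (range-linked 0 a)) into-zig (zz-linked r a n true))
                       wrap-to-top (column-linked (range-linked 0 a))
      where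
      into-zig : Adj r (lastOf (0 , 0) (column 0 (range 1 a′))) (a , 0)
      into-zig = subst (λ w → Adj r w (a , 0)) (sym end₀) (inj₂ (refl , inj₁ (inj₁ refl)))
      wrap-to-top : Adj r (lastOf (0 , 0) (column 0 (range 1 a′) ++ zig)) (0 , 1)
      wrap-to-top = subst (λ w → Adj r w (0 , 1)) (sym end₁) (inj₂ (refl , inj₁ (inj₂ (sym (ℕP.+-suc a (2 * k)) , refl))))

sweepEnd-ascending : ∀ r t n → sweepEnd r (t + n) (replicate n true) ≡ t
sweepEnd-ascending r t zero = ℕP.+-identityʳ t
sweepEnd-ascending r t (suc n) = trans (cong (λ y → sweepEnd r (prev r y) (replicate n true)) (ℕP.+-suc t n))
                                      (sweepEnd-ascending r t n)

form1-zigzag : ∀ m k t c′ → k ≤ m → Form1Path (suc (t + c′) + suc (2 * k)) (suc (suc c′)) m t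
form1-zigzag m k t c′ k≤m with append-sweep (replicate c′ true) (ℕP.<-≤-trans (ℕP.n<1+n (t + c′)) (ℕP.m≤m+n a n))
                                            path-hamPath path-end
  where open ZigzagPrefix (t + c′) k
... | hp , end , hcount≡ =
  form1-path {m = m} k S (0 , 0) ((column 0 (range 1 (t + c′)) ++ zig) ++ top₁ ++ C)
    (subst₂ (HamPath r) (trans (cong (_+ 2) length-c′) (ℕP.+-comm c′ 2)) (ListP.++-assoc (top₀ ++ zig) top₁ C) hp)
    (trans (cong (lastOf (0 , 0)) (sym (ListP.++-assoc (column 0 (range 1 (t + c′)) ++ zig) top₁ C)))
           (trans end (cong₂ _,_ (sweepEnd-ascending r t c′) (trans (cong (_+ 1) length-c′) (ℕP.+-comm c′ 1)))))
    (subst (_≤ r) (ℕP.+-comm 1 (2 * k)) (ℕP.m≤n+m n a))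
    (cong (_++ S) path≡prefix1)
    (ColumnsFrom-column (range 0 a) (ColumnsFrom-sweep r (t + c′) 2 (replicate c′ true)))
    (subst (_≤ 2 * m + suc c′) (sym (trans (cong hcount (sym (ListP.++-assoc (top₀ ++ zig) top₁ C)))
                                       (trans hcount≡ (cong₂ _+_ length-c′ path-hcount))))
           (subst (_≤ 2 * m + suc c′) count (ℕP.+-monoˡ-≤ (suc c′) (ℕP.*-monoʳ-≤ 2 k≤m))))
  where
  open ZigzagPrefix (t + c′) k
  C = sweep r (t + c′) 2 (replicate c′ true)
  S = top₁ ++ C
  length-c′ : length (replicate c′ true) ≡ c′
  length-c′ = ListP.length-replicate c′
  count : 2 * k + suc c′ ≡ c′ + n
  count = trans (ℕP.+-suc (2 * k) c′) (trans (cong suc (ℕP.+-comm (2 * k) c′)) (sym (ℕP.+-suc c′ (2 * k))))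

reflectV : ℕ → Vertex → Vertex
reflectV r v = (reflect r (row v) , col v)

map-reflectV-involutive : ∀ {r c} Q → All (InGrid r c) Q → map (reflectV r) (map (reflectV r) Q) ≡ Q
map-reflectV-involutive [] _ = refl
map-reflectV-involutive ((i , j) ∷ Q) ((i<r , _) ∷ Q-inGrid) =
  cong₂ _∷_ (cong (_, j) (reflect-involutive i<r)) (map-reflectV-involutive Q Q-inGrid)

hcount-reflect : ∀ r Q → hcount (map (reflectV r) Q) ≡ hcount Q
hcount-reflect r [] = refl
hcount-reflect r (u ∷ []) = refl
hcount-reflect r (u ∷ v ∷ Q) = cong (_+_ (if col u ℕ.≡ᵇ col v then 0 else 1)) (hcount-reflect r (v ∷ Q))

HamPath-reflect : ∀ {r c Q} → HamPath r c Q → HamPath r c (map (reflectV r) Q)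
HamPath-reflect {r} {c} {Q} (inGrid , unique , covers , linked) = inGrid′ , unique′ , covers′ , linked′
  where
  inGrid′ : All (InGrid r c) (map (reflectV r) Q)
  inGrid′ = All.map⁺ (All.map (Product.map₁ reflect-<) inGrid)
  unique′ : Unique (map (reflectV r) Q)
  unique′ = Unique.map⁻ (subst Unique (sym (map-reflectV-involutive Q inGrid)) unique)
  covers′ : ∀ v → InGrid r c v → v ∈ map (reflectV r) Q
  covers′ (i , j) (i<r , j<c) = subst (_∈ map (reflectV r) Q) (cong (_, j) (reflect-involutive i<r))
                                      (∈-map⁺ (reflectV r) (covers (reflect r i , j) (reflect-< i<r , j<c)))
  reflect-Adj : ∀ {u v} → InGrid r c u → InGrid r c v → Adj r u v → Adj r (reflectV r u) (reflectV r v)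
  reflect-Adj _ _ (inj₁ (same-row , step)) = inj₁ (cong (reflect r) same-row , step)
  reflect-Adj (i<r , _) (i′<r , _) (inj₂ (same-col , step)) = inj₂ (same-col , reflect-RowAdj i<r i′<r step)
  linked′ : Linked (Adj r) (map (reflectV r) Q)
  linked′ = Linked-map (reflectV r) reflect-Adj inGrid linked

Form1Path⇒InA-reflect : ∀ {r c m t} → Form1Path r c m t → InA r c m (reflect r t)
Form1Path⇒InA-reflect {r} {c} {m} {t} (k , Q , S , hp , k<r , shape , columns , few , init , ends) =
  k , map (reflectV r) Q ,
  (HamPath-reflect hp , k<r , map (reflectV r) S ,
   inj₂ (trans (cong (map (reflectV r)) shape) (ListP.map-++ (reflectV r) (prefix1 r k) S)) ,
   subst (λ cs → Linked _≤_ (1 ∷ cs)) (ListP.map-∘ S) columns) ,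
  subst (_≤ 2 * m + (c ∸ 1)) (sym (hcount-reflect r Q)) few ,
  map (reflectV r) init , trans (cong (map (reflectV r)) ends) (ListP.map-++ (reflectV r) init _)

backAndForth : ℕ → List Bool
backAndForth zero = []
backAndForth (suc q) = true ∷ false ∷ backAndForth q

length-backAndForth : ∀ q → length (backAndForth q) ≡ 2 * q
length-backAndForth zero = refl
length-backAndForth (suc q) = cong suc (trans (cong suc (length-backAndForth q)) (sym (ℕP.+-suc q (q + 0))))

sweepEnd-backAndForth : ∀ {r y} q → y < r → sweepEnd r y (backAndForth q) ≡ y
sweepEnd-backAndForth zero _ = refl
sweepEnd-backAndForth {r} {y} (suc q) y<r =
  trans (cong (λ y′ → sweepEnd r y′ (backAndForth q)) (next-prev y<r)) (sweepEnd-backAndForth q y<r)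

sweepEnd-++ : ∀ r y xs ys → sweepEnd r y (xs ++ ys) ≡ sweepEnd r (sweepEnd r y xs) ys
sweepEnd-++ r y [] ys = refl
sweepEnd-++ r y (b ∷ xs) ys = sweepEnd-++ r (tourEnd r b y) xs ys

-- Sweep e - 1 columns upwards, then go back and forth to fill the remaining columns.
form1-near : ∀ {m c t e} → 2 ≤ c → 1 ≤ e → e ≤ c → sign e ≡ sign c → Form1Path (t + e) c m t
form1-near {m} {c} {t} {suc e′} 2≤c _ e≤c sign-e
  with sign-≡⇒even-gap (suc e′) (c ∸ suc e′) (trans sign-e (cong sign (sym c≡)))
  where
  c≡ : suc e′ + (c ∸ suc e′) ≡ c
  c≡ = ℕP.m+[n∸m]≡n e≤c
... | q , gap = subst₂ (λ r c → Form1Path r c m t) (sym (ℕP.+-suc t e′)) length-bs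
                       (subst (Form1Path (suc (t + e′)) (suc (length bs)) m) ends
                              (form1-corner-sweep m (t + e′) bs nonempty))
  where
  bs = replicate e′ true ++ backAndForth q
  length-bs : suc (length bs) ≡ c
  length-bs = trans (cong suc (trans (ListP.length-++ (replicate e′ true))
                                     (cong₂ _+_ (ListP.length-replicate e′) (length-backAndForth q))))
                    (trans (cong (_+_ (suc e′)) (sym gap)) (ℕP.m+[n∸m]≡n e≤c))
  nonempty : 1 ≤ length bs
  nonempty = ℕP.≤-pred (subst (2 ≤_) (sym length-bs) 2≤c)
  ends : sweepEnd (suc (t + e′)) (t + e′) bs ≡ t
  ends = trans (sweepEnd-++ _ (t + e′) (replicate e′ true) (backAndForth q))
               (trans (cong (λ y → sweepEnd (suc (t + e′)) y (backAndForth q)) (sweepEnd-ascending _ t e′))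
                      (sweepEnd-backAndForth q (s≤s (ℕP.m≤m+n t e′))))

-- Zig-zag through (e - c) / 2 extra pairs of rows, then sweep the remaining columns upwards.
form1-far : ∀ {m c t e} → 2 ≤ c → c ≤ e → sign e ≡ sign c → e ≤ 2 * m + c → Form1Path (t + e) c m t
form1-far {c = zero} ()
form1-far {c = suc zero} (s≤s ())
form1-far {m} {c@(suc (suc c′))} {t} {e} _ c≤e sign-e e≤2m+c
  with sign-≡⇒even-gap c (e ∸ c) (trans (sym sign-e) (cong sign (sym (ℕP.m+[n∸m]≡n c≤e))))
... | k , gap = subst (λ r → Form1Path r c m t) rows (form1-zigzag m k t c′ k≤m)
  where
  e≡ : e ≡ c + 2 * k
  e≡ = trans (sym (ℕP.m+[n∸m]≡n c≤e)) (cong (_+_ c) gap)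
  k≤m : k ≤ m
  k≤m = ℕP.*-cancelˡ-≤ 2 (ℕP.+-cancelʳ-≤ c (2 * k) (2 * m) (subst (_≤ 2 * m + c) (trans e≡ (ℕP.+-comm c (2 * k))) e≤2m+c))
  rows : suc (t + c′) + suc (2 * k) ≡ t + e
  rows = trans (regroup t c′ (2 * k)) (cong (_+_ t) (sym e≡))
    where
    regroup : ∀ t c k → suc (t + c) + suc k ≡ t + (suc (suc c) + k)
    regroup = ℕSolver.solve-∀

form1-reaches : ∀ {m c t e} → 2 ≤ c → 1 ≤ e → sign e ≡ sign c → e ≤ 2 * m + c → Form1Path (t + e) c m t
form1-reaches {m} {c} {t} {e} 2≤c 1≤e sign-e e≤2m+c with e ℕ.≤? c
... | yes e≤c = form1-near {m} 2≤c 1≤e e≤c sign-e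
... | no e≰c = form1-far {m} 2≤c (ℕP.<⇒≤ (ℕP.≰⇒> e≰c)) sign-e e≤2m+c

-- For even c, sweeping column 1 downwards from row r - 1 wraps around to row 0.
form1-row0 : ∀ {m r c} → 1 ≤ r → 2 ≤ c → sign c ≡ 1ℤ → Form1Path r c m 0
form1-row0 {m} {suc r′} {c} _ 2≤c even-c with sign≡1⇒even c even-c
... | zero , refl = ⊥-elim (ℕP.<-irrefl refl (ℕP.<-≤-trans (s≤s z≤n) 2≤c))
... | suc q , refl = subst₂ (λ c t → Form1Path (suc r′) c m t) columns ends
                            (form1-corner-sweep m r′ (false ∷ backAndForth q) (s≤s z≤n))
  where
  columns : suc (length (false ∷ backAndForth q)) ≡ 2 * suc q
  columns = trans (cong (λ n → suc (suc n)) (length-backAndForth q)) (cong suc (sym (ℕP.+-suc q (q + 0))))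
  ends : sweepEnd (suc r′) r′ (false ∷ backAndForth q) ≡ 0
  ends = trans (cong (λ y → sweepEnd (suc r′) y (backAndForth q)) (sym (VStep⇒≡next (s≤s z≤n) (inj₂ (refl , refl)))))
               (sweepEnd-backAndForth q (s≤s z≤n))

within-reach⇒InA : ∀ {r c m x} → 2 ≤ c → x < r → WithinReach r c (2 * m + c) x → InA r c m x
within-reach⇒InA {r} {c} {m} {zero} 2≤c 0<r (inj₁ (sign-x , _)) = Form1Path⇒InA {m = m} (form1-row0 {m} 0<r 2≤c (sym sign-x))
within-reach⇒InA {r} {c} {m} {x@(suc _)} 2≤c x<r (inj₁ (sign-x , x≤)) =
  subst (InA r c m) (reflect-involutive x<r)
        (Form1Path⇒InA-reflect {m = m} (subst (λ r′ → Form1Path r′ c m (r ∸ x)) (ℕP.m∸n+n≡m (ℕP.<⇒≤ x<r))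
                                      (form1-reaches {m} 2≤c (s≤s z≤n) sign-x x≤)))
within-reach⇒InA {r} {c} {m} {x} 2≤c x<r (inj₂ (sign-r∸x , r∸x≤)) =
  Form1Path⇒InA {m = m} (subst (λ r′ → Form1Path r′ c m x) (ℕP.m+[n∸m]≡n (ℕP.<⇒≤ x<r))
                       (form1-reaches {m} 2≤c (ℕP.m<n⇒0<n∸m x<r) sign-r∸x r∸x≤))

theorem3 : (r c m : ℕ) → 2 ≤ r → 2 ≤ c →
    (P : List Vertex) → HamPath r c P →
    (∃[ rest ] P ≡ (0 , 0) ∷ rest) →
    (x : ℕ) → (∃[ init ] P ≡ init ∷ʳ (x , c ∸ 1)) →
    hcount P ≤ (c ∸ 1) + 2 * m →
    InA r c m x
theorem3 r zero m _ () _ _ _ _ _ _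
theorem3 r (suc j) m 2≤r 2≤c .((0 , 0) ∷ rest) hp (rest , refl) x (init , ends) few =
  within-reach⇒InA {m = m} 2≤c (FromCorner.end<r hp end) (FromCorner.within-reach hp end 2≤r steps<N (sign-2*+ m (suc j)))
  where
  end : lastOf (0 , 0) rest ≡ (x , j)
  end = ∷ʳ⇒lastOf (0 , 0) rest init (x , j) ends
  steps<N : hcount ((0 , 0) ∷ rest) + 1 ≤ 2 * m + suc j
  steps<N = subst₂ _≤_ (ℕP.+-comm 1 _) (trans (cong suc (ℕP.+-comm j (2 * m))) (sym (ℕP.+-suc (2 * m) j))) (s≤s few)
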